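{- Let $\ell\ge2$, let $D=(b|g;f_1,\dots,f_\ell)=(d_{n,k})_{n,k\ge0}$ be a multiple almost-Riordan array, and let $A=(a_k)_{k\ge0}$, $Z_j=(z_{j,k})_{k\ge0}$ ($j=1,\dots,\ell$) and $W=(w_k)_{k\ge0}$ be its $A$-, $Z_j$- and $W$-sequences, with generating functions $A(t)=\sum_{k\ge0}a_kt^{\ell k}$, $Z_j(t)=\sum_{k\ge0}z_{j,k}t^{\ell k}$, $W(t)=\sum_{k\ge0}w_kt^{\ell k}$. Let $h=\sqrt[\ell]{f_1\cdots f_\ell}$ and let $\overline h$ be its compositional inverse. Then $$A(t)=\frac{t^\ell}{\overline h^\ell},\qquad Z_1(t)=\frac1{\overline h^\ell}\Bigl(1-\frac{g_0}{g(\overline h)}\Bigr),$$ $$Z_m(t)=\frac1{\overline h^\ell}\Bigl(1-\frac{g_0f_{1,1}f_{2,1}\cdots f_{m-1,1}\,\overline h^{\,m-1}}{g(\overline h)f_1(\overline h)f_2(\overline h)\cdots f_{m-1}(\overline h)}\Bigr)\quad(m=2,\dots,\ell-1),$$ $$Z_\ell(t)=\frac{g_0f_{1,1}f_{2,1}\cdots f_{\ell-1,1}}{b_0}+\frac{t^\ell}{\overline h^\ell}-\frac{g_0f_{1,1}f_{2,1}\cdots f_{\ell-1,1}\,b(\overline h)f_\ell(\overline h)}{b_0\,\overline h\,g(\overline h)},$$ $$W(t)=\frac{f_\ell(\overline h)\bigl((1-w_0\overline h^\ell)b(\overline h)-b_0\bigr)}{\overline h^{\,\ell+1}g(\overline h)}+w_0,\qquad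 w_0=\frac{b_\ell}{b_0},$$ where $b_\ell=[t^\ell]b(t)$ and $f_{j,1}=[t]f_j(t)$.
   Context: Fix an integer $\ell\ge2$ and a field $\mathbb K$ of characteristic $0$; $\mathbb K[[t^\ell]]$ denotes the formal power series in $t^\ell$. Let $b,g\in\mathbb K[[t^\ell]]$ with $b_0:=b(0)\ne0$, $g_0:=g(0)\ne0$, and $f_1,\dots,f_\ell\in t\mathbb K[[t^\ell]]$ with $f_{j,1}:=[t]f_j\ne0$. The multiple almost-Riordan array $(b|g;f_1,\dots,f_\ell)$ is the infinite lower triangular matrix $(d_{n,k})_{n,k\ge0}$ with $d_{n,0}=[t^n]b(t)$ and, for $k\ge1$, $d_{n,k}=[t^n]\,t\,g\,f_1^{e_1(k)}\cdots f_\ell^{e_\ell(k)}$ with $e_i(k)=\lfloor (k-1+\ell-i)/\ell\rfloor$ (columns $b, tg, tgf_1, tgf_1f_2,\dots,tgf_1\cdots f_\ell, tgf_1^2f_2\cdots f_\ell,\dots$). Its $A$-, $Z_j$- and $W$-sequences are the sequences satisfying, for all $n\ge0$ (entries with column index exceeding the row index being $0$): $d_{n+\ell,k}=\sum_{j\ge0}a_j\,d_{n,k-\ell+\ell j}$ for every $k>\ell$; $d_{n+\ell,m}=\sum_{j\ge0}z_{m,j}\,d_{n,m+\ell j}$ for $m=1,\dots,\ell-1$; $d_{n+\ell,\ell}=\sum_{j\ge0}z_{\ell,j}\,d_{n,\ell j}$; $d_{n+\ell,0}=\sum_{j\ge0}w_j\,d_{n,\ell j}$. $h\in t\mathbb K[[t]]$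 denotes a formal power series with $h^\ell=f_1f_2\cdots f_\ell$ (assumed to exist, e.g. when $\mathbb K$ is algebraically closed), $\overline h$ its compositional inverse, and $g(\overline h)$ etc. denote composition. -}

module Defs where

open import Level using (Level; _⊔_)
open import Algebra.Bundles using (CommutativeRing)
open import Data.Nat as ℕ using (ℕ; zero; suc; _∸_; NonZero)
open import Data.Nat.DivMod using (_/_)
open import Data.Nat.Divisibility using (_∣_; _∣?_)
open import Data.Product using (_×_; ∃)
open import Relation.Nullary using (¬_; yes; no)

IsField : ∀ {c r} → CommutativeRing c r → Set (c ⊔ r)
IsField R = (¬ (1# ≈ 0#)) × (∀ x → ¬ (x ≈ 0#) → ∃ λ y → (x * y) ≈ 1#)
  where open CommutativeRing R

module PS {c r} (R : CommutativeRing c r) where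
  open CommutativeRing R

  natC : ℕ → Carrier
  natC zero    = 0#
  natC (suc n) = 1# + natC n

  CharZero : Set r
  CharZero = ∀ n → ¬ (natC (suc n) ≈ 0#)

  sumTo : ℕ → (ℕ → Carrier) → Carrier
  sumTo zero    f = 0#
  sumTo (suc n) f = sumTo n f + f n

  Series : Set c
  Series = ℕ → Carrier

  infix 4 _≋_
  _≋_ : Series → Series → Set r
  F ≋ G = ∀ n → F n ≈ G n

  infixl 6 _⊕_ _⊖_
  infixl 7 _⊛_ _·ₛ_
  _⊕_ : Series → Series → Series
  (F ⊕ G) n = F n + G n

  _⊖_ : Series → Series → Series
  (F ⊖ G) n = F n - G n

  _·ₛ_ : Carrier → Series → Series
  (a ·ₛ F) n = a * F n

  _⊛_ : Series → Series → Series
  (F ⊛ G) n = sumTo (suc n) (λ i → F i * G (n ∸ i))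

  const : Carrier → Series
  const a zero    = a
  const a (suc n) = 0#

  oneS : Series
  oneS = const 1#

  tpow : ℕ → Series
  tpow k n with k ℕ.≟ n
  ... | yes _ = 1#
  ... | no  _ = 0#

  tS : Series
  tS = tpow 1

  pow : Series → ℕ → Series
  pow F zero    = oneS
  pow F (suc k) = F ⊛ pow F k

  -- composition F(G) (meaningful when G(0) = 0):  [t^n] F(G) = Σ_{k ≤ n} F_k [t^n] G^k
  comp : Series → Series → Series
  comp F G n = sumTo (suc n) (λ k → F k * pow G k n)

  -- product f_1 f_2 ⋯ f_m  of series indexed from 1
  prodS : ℕ → (ℕ → Series) → Series
  prodS zero    f = oneS
  prodS (suc m) f = prodS m f ⊛ f (suc m)

  prodC : ℕ → (ℕ → Carrier) → Carrier
  prodC zero    x = 1#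
  prodC (suc m) x = prodC m x * x (suc m)

  InPowSeries : ℕ → Series → Set r
  InPowSeries ℓ F = ∀ n → ¬ (ℓ ∣ n) → F n ≈ 0#

  InTPowSeries : ℕ → Series → Set r
  InTPowSeries ℓ F = (F 0 ≈ 0#) × (∀ n → ¬ (ℓ ∣ n) → F (suc n) ≈ 0#)

  spread : ℕ → (ℕ → Carrier) → Series
  spread ℓ a n with ℓ ∣? n
  ... | yes p = a (_∣_.quotient p)
  ... | no  _ = 0#

  expo : (ℓ : ℕ) → .{{NonZero ℓ}} → ℕ → ℕ → ℕ
  expo ℓ i k = ((k ∸ 1) ℕ.+ (ℓ ∸ i)) / ℓ

  -- k-th column of the multiple almost-Riordan array (b | g ; f_1, …, f_ℓ)
  column : (ℓ : ℕ) → .{{NonZero ℓ}} → Series → Series → (ℕ → Series) → ℕ → Series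
  column ℓ b g f zero    = b
  column ℓ b g f (suc k) =
    tS ⊛ g ⊛ prodS ℓ (λ i → pow (f i) (expo ℓ i (suc k)))

  entry : (ℓ : ℕ) → .{{NonZero ℓ}} → Series → Series → (ℕ → Series) → ℕ → ℕ → Carrier
  entry ℓ b g f n k = column ℓ b g f k n

  -- The sums Σ_{j ≥ 0} are
  -- truncated at j ≤ n: all omitted terms involve entries d_{n,k'} with k' > n, which
  -- vanish (column k' of the array has order ≥ k').
  module _ (ℓ : ℕ) .{{_ : NonZero ℓ}} (b g : Series) (f : ℕ → Series) where
    private d = entry ℓ b g f

    IsASequence : (ℕ → Carrier) → Set r
    IsASequence a = ∀ n k → ℓ ℕ.< k →
      d (n ℕ.+ ℓ) k ≈ sumTo (suc n) (λ j → a j * d n ((k ∸ ℓ) ℕ.+ ℓ ℕ.* j))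

    -- Z_m-sequence for m = 1, …, ℓ-1
    IsZSequence : ℕ → (ℕ → Carrier) → Set r
    IsZSequence m z = ∀ n →
      d (n ℕ.+ ℓ) m ≈ sumTo (suc n) (λ j → z j * d n (m ℕ.+ ℓ ℕ.* j))

    IsZℓSequence : (ℕ → Carrier) → Set r
    IsZℓSequence z = ∀ n →
      d (n ℕ.+ ℓ) ℓ ≈ sumTo (suc n) (λ j → z j * d n (ℓ ℕ.* j))

    IsWSequence : (ℕ → Carrier) → Set r
    IsWSequence w = ∀ n →
      d (n ℕ.+ ℓ) 0 ≈ sumTo (suc n) (λ j → w j * d n (ℓ ℕ.* j))

{-# OPTIONS --safe #-}
-- For m < ℓ, column m + 1 of the array is t g f₁ ⋯ fₘ, and since f₁ ⋯ f_ℓ = h^ℓ, raising a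
-- column index by ℓ j multiplies the column by h^{ℓ j}.  A row relation
-- d_{n+ℓ,k} = Σ_j s_j d_{n,m+ℓj} therefore says that column k, stripped of its first ℓ
-- coefficients and divided by t^ℓ, is column m times S(h), where S(t) = Σ_j s_j t^{ℓ j}.
-- Substituting h̄ for t turns S(h) into S and h^ℓ into t^ℓ; the resulting identities are
-- solved for S by cancelling h̄ and g(h̄), which are t times a unit and a unit respectively.
module Submission where

open import Defs
open import Algebra.Bundles using (CommutativeRing)
open import Data.Nat as ℕ using (ℕ; zero; suc; _∸_; _≤_; _<_; z≤n; s≤s; NonZero)
import Data.Nat.Properties as ℕ
open import Data.Product using (_×_; _,_; proj₁; proj₂)
open import Relation.Nullary using (¬_; yes; no; contradiction)
open import Relation.Binary.PropositionalEquality as ≡ using (_≡_; _≢_)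
open import Function using (_∘_; _$_; case_of_)
import Algebra.Solver.Ring.NaturalCoefficients.Default
import Relation.Binary.Reasoning.Setoid

AllUpTo : ∀ {p} → ℕ → (ℕ → Set p) → Set p
AllUpTo m P = ∀ i → 1 ≤ i → i ≤ m → P i

allUpTo-init : ∀ {p} {m} {P : ℕ → Set p} → AllUpTo (suc m) P → AllUpTo m P
allUpTo-init all i 1≤i i≤m = all i 1≤i (ℕ.m≤n⇒m≤1+n i≤m)

allUpTo-last : ∀ {p} {m} {P : ℕ → Set p} → AllUpTo (suc m) P → P (suc m)
allUpTo-last all = all _ (s≤s z≤n) ℕ.≤-refl

allUpTo-≤ : ∀ {p} {m n} {P : ℕ → Set p} → m ≤ n → AllUpTo n P → AllUpTo m P
allUpTo-≤ m≤n all i 1≤i i≤m = all i 1≤i (ℕ.≤-trans i≤m m≤n)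

module FiniteSums {c r} (K : CommutativeRing c r) where
  open CommutativeRing K
  open PS K
  open import Relation.Binary.Reasoning.Setoid setoid
  open import Algebra.Properties.CommutativeSemigroup +-commutativeSemigroup using (interchange)

  sumTo-cong-< : ∀ n {f g : ℕ → Carrier} → (∀ i → i < n → f i ≈ g i) → sumTo n f ≈ sumTo n g
  sumTo-cong-< zero    f≈g = refl
  sumTo-cong-< (suc n) f≈g = +-cong (sumTo-cong-< n (λ i i<n → f≈g i (ℕ.m<n⇒m<1+n i<n))) (f≈g n ℕ.≤-refl)

  sumTo-cong : ∀ n {f g : ℕ → Carrier} → (∀ i → f i ≈ g i) → sumTo n f ≈ sumTo n g
  sumTo-cong n f≈g = sumTo-cong-< n (λ i _ → f≈g i)

  sumTo-zero : ∀ n {f : ℕ → Carrier} → (∀ i → i < n → f i ≈ 0#) → sumTo n f ≈ 0#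
  sumTo-zero zero    f≈0 = refl
  sumTo-zero (suc n) f≈0 = trans (+-cong (sumTo-zero n (λ i i<n → f≈0 i (ℕ.m<n⇒m<1+n i<n))) (f≈0 n ℕ.≤-refl))
                                 (+-identityˡ 0#)

  sumTo-distrib-+ : ∀ n (f g : ℕ → Carrier) → sumTo n (λ i → f i + g i) ≈ sumTo n f + sumTo n g
  sumTo-distrib-+ zero    f g = sym (+-identityˡ 0#)
  sumTo-distrib-+ (suc n) f g = trans (+-congʳ (sumTo-distrib-+ n f g)) (interchange _ _ _ _)

  *-distribˡ-sumTo : ∀ n x (f : ℕ → Carrier) → x * sumTo n f ≈ sumTo n (λ i → x * f i)
  *-distribˡ-sumTo zero    x f = zeroʳ x
  *-distribˡ-sumTo (suc n) x f = trans (distribˡ x _ _) (+-congʳ (*-distribˡ-sumTo n x f))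

  *-distribʳ-sumTo : ∀ n x (f : ℕ → Carrier) → sumTo n f * x ≈ sumTo n (λ i → f i * x)
  *-distribʳ-sumTo zero    x f = zeroˡ x
  *-distribʳ-sumTo (suc n) x f = trans (distribʳ x _ _) (+-congʳ (*-distribʳ-sumTo n x f))

  sumTo-comm : ∀ m n (X : ℕ → ℕ → Carrier) →
    sumTo m (λ i → sumTo n (λ j → X i j)) ≈ sumTo n (λ j → sumTo m (λ i → X i j))
  sumTo-comm zero    n X = sym (sumTo-zero n (λ _ _ → refl))
  sumTo-comm (suc m) n X = trans (+-congʳ (sumTo-comm m n X)) (sym (sumTo-distrib-+ n _ _))

  sumTo-head : ∀ n (f : ℕ → Carrier) → sumTo (suc n) f ≈ f 0 + sumTo n (λ i → f (suc i))
  sumTo-head zero    f = trans (+-identityˡ _) (sym (+-identityʳ _))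
  sumTo-head (suc n) f = trans (+-congʳ (sumTo-head n f)) (+-assoc _ _ _)

  sumTo-split : ∀ m n (f : ℕ → Carrier) → sumTo (n ℕ.+ m) f ≈ sumTo m f + sumTo n (λ i → f (i ℕ.+ m))
  sumTo-split m zero    f = sym (+-identityʳ _)
  sumTo-split m (suc n) f = trans (+-congʳ (sumTo-split m n f)) (+-assoc _ _ _)

  sumTo-extend : ∀ m n (f : ℕ → Carrier) → m ≤ n → (∀ i → m ≤ i → i < n → f i ≈ 0#) → sumTo m f ≈ sumTo n f
  sumTo-extend m n f m≤n f≈0 = begin
    sumTo m f                                         ≈⟨ +-identityʳ _ ⟨
    sumTo m f + 0#                                    ≈⟨ +-congˡ (sumTo-zero (n ∸ m) tail≈0) ⟨
    sumTo m f + sumTo (n ∸ m) (λ i → f (i ℕ.+ m))     ≈⟨ sumTo-split m (n ∸ m) f ⟨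
    sumTo (n ∸ m ℕ.+ m) f                              ≡⟨ ≡.cong (λ k → sumTo k f) (ℕ.m∸n+n≡m m≤n) ⟩
    sumTo n f                                         ∎
    where
    tail≈0 : ∀ i → i < n ∸ m → f (i ℕ.+ m) ≈ 0#
    tail≈0 i i<n∸m = f≈0 (i ℕ.+ m) (ℕ.m≤n+m m i) (ℕ.<-≤-trans (ℕ.+-monoˡ-< m i<n∸m) (ℕ.≤-reflexive (ℕ.m∸n+n≡m m≤n)))

  sumTo-single : ∀ n k (f : ℕ → Carrier) → k < n → (∀ i → i < n → i ≢ k → f i ≈ 0#) → sumTo n f ≈ f k
  sumTo-single (suc n) k f k≤n f≈0 with k ℕ.≟ n
  ... | yes ≡.refl = trans (+-congʳ (sumTo-zero n (λ i i<n → f≈0 i (ℕ.m<n⇒m<1+n i<n) (ℕ.<⇒≢ i<n))))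
                           (+-identityˡ _)
  ... | no k≢n = trans (+-cong (sumTo-single n k f (ℕ.≤∧≢⇒< (ℕ.≤-pred k≤n) k≢n)
                                             (λ i i<n → f≈0 i (ℕ.m<n⇒m<1+n i<n)))
                               (f≈0 n ℕ.≤-refl (k≢n ∘ ≡.sym)))
                       (+-identityʳ _)

  sumTo-reverse : ∀ n (f : ℕ → Carrier) → sumTo (suc n) f ≈ sumTo (suc n) (λ i → f (n ∸ i))
  sumTo-reverse zero    f = refl
  sumTo-reverse (suc n) f = begin
    sumTo (suc (suc n)) f                            ≈⟨ sumTo-head (suc n) f ⟩
    f 0 + sumTo (suc n) (λ i → f (suc i))            ≈⟨ +-congˡ (sumTo-reverse n (λ i → f (suc i))) ⟩
    f 0 + sumTo (suc n) (λ i → f (suc (n ∸ i)))      ≈⟨ +-comm _ _ ⟩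
    sumTo (suc n) (λ i → f (suc (n ∸ i))) + f 0      ≈⟨ +-cong (sumTo-cong-< (suc n) reindex) last ⟩
    sumTo (suc (suc n)) (λ i → f (suc n ∸ i))        ∎
    where
    reindex : ∀ i → i < suc n → f (suc (n ∸ i)) ≈ f (suc n ∸ i)
    reindex i i≤n = reflexive (≡.cong f (≡.sym (ℕ.+-∸-assoc 1 (ℕ.≤-pred i≤n))))
    last : f 0 ≈ f (suc n ∸ suc n)
    last = reflexive (≡.cong f (≡.sym (ℕ.n∸n≡0 n)))

  sumTo-triangle : ∀ n (X : ℕ → ℕ → Carrier) →
    sumTo (suc n) (λ k → sumTo (suc k) (λ i → X i (k ∸ i))) ≈
    sumTo (suc n) (λ i → sumTo (suc (n ∸ i)) (λ j → X i j))
  sumTo-triangle zero    X = refl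
  sumTo-triangle (suc n) X = begin
    sumTo (suc n) (λ k → sumTo (suc k) (λ i → X i (k ∸ i))) + sumTo (suc (suc n)) (λ i → X i (suc n ∸ i))
      ≈⟨ +-cong (sumTo-triangle n X) (+-congˡ (reflexive (≡.cong (X (suc n)) (ℕ.n∸n≡0 n)))) ⟩
    R + (sumTo (suc n) (λ i → X i (suc n ∸ i)) + X (suc n) 0)
      ≈⟨ +-assoc _ _ _ ⟨
    (R + sumTo (suc n) (λ i → X i (suc n ∸ i))) + X (suc n) 0
      ≈⟨ +-congʳ (sumTo-distrib-+ (suc n) _ _) ⟨
    sumTo (suc n) (λ i → sumTo (suc (n ∸ i)) (X i) + X i (suc n ∸ i)) + X (suc n) 0
      ≈⟨ +-cong (sumTo-cong-< (suc n) row) (sym (+-identityˡ _)) ⟩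
    sumTo (suc n) (λ i → sumTo (suc (suc n ∸ i)) (X i)) + sumTo 1 (X (suc n))
      ≡⟨ ≡.cong (λ k → sumTo (suc n) (λ i → sumTo (suc (suc n ∸ i)) (X i)) + sumTo (suc k) (X (suc n))) (ℕ.n∸n≡0 n) ⟨
    sumTo (suc (suc n)) (λ i → sumTo (suc (suc n ∸ i)) (λ j → X i j)) ∎
    where
    R : Carrier
    R = sumTo (suc n) (λ i → sumTo (suc (n ∸ i)) (λ j → X i j))
    row : ∀ i → i < suc n → sumTo (suc (n ∸ i)) (X i) + X i (suc n ∸ i) ≈ sumTo (suc (suc n ∸ i)) (X i)
    row i i≤n rewrite ℕ.+-∸-assoc 1 (ℕ.≤-pred i≤n) = refl

module SeriesRing {c r} (K : CommutativeRing c r) where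
  open CommutativeRing K
  open PS K
  open FiniteSums K
  open import Relation.Binary.Reasoning.Setoid setoid
  import Algebra.Construct.Pointwise ℕ as Pointwise

  ⊛-cong : ∀ {F F′ G G′} → F ≋ F′ → G ≋ G′ → F ⊛ G ≋ F′ ⊛ G′
  ⊛-cong F≋F′ G≋G′ n = sumTo-cong (suc n) (λ i → *-cong (F≋F′ i) (G≋G′ (n ∸ i)))

  ⊛-congˡ : ∀ F {G G′} → G ≋ G′ → F ⊛ G ≋ F ⊛ G′
  ⊛-congˡ F = ⊛-cong {F} (λ _ → refl)

  ⊛-congʳ : ∀ G {F F′} → F ≋ F′ → F ⊛ G ≋ F′ ⊛ G
  ⊛-congʳ G F≋F′ = ⊛-cong {G = G} F≋F′ (λ _ → refl)

  ⊛-comm : ∀ F G → F ⊛ G ≋ G ⊛ F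
  ⊛-comm F G n = trans (sumTo-reverse n _) (sumTo-cong-< (suc n) swap)
    where
    swap : ∀ i → i < suc n → F (n ∸ i) * G (n ∸ (n ∸ i)) ≈ G i * F (n ∸ i)
    swap i i≤n = trans (*-comm _ _) (*-congʳ (reflexive (≡.cong G (ℕ.m∸[m∸n]≡n (ℕ.≤-pred i≤n)))))

  ⊛-assoc : ∀ F G H → (F ⊛ G) ⊛ H ≋ F ⊛ (G ⊛ H)
  ⊛-assoc F G H n = begin
    sumTo (suc n) (λ k → sumTo (suc k) (λ i → F i * G (k ∸ i)) * H (n ∸ k))
      ≈⟨ sumTo-cong (suc n) (λ k → trans (*-distribʳ-sumTo (suc k) _ _) (sumTo-cong-< (suc k) (reassoc k))) ⟩
    sumTo (suc n) (λ k → sumTo (suc k) (λ i → X i (k ∸ i)))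
      ≈⟨ sumTo-triangle n X ⟩
    sumTo (suc n) (λ i → sumTo (suc (n ∸ i)) (λ j → X i j))
      ≈⟨ sumTo-cong (suc n) (λ i → *-distribˡ-sumTo (suc (n ∸ i)) _ _) ⟨
    (F ⊛ (G ⊛ H)) n ∎
    where
    X : ℕ → ℕ → Carrier
    X i j = F i * (G j * H (n ∸ i ∸ j))
    reassoc : ∀ k i → i < suc k → (F i * G (k ∸ i)) * H (n ∸ k) ≈ X i (k ∸ i)
    reassoc k i i≤k = trans (*-assoc _ _ _) (*-congˡ (*-congˡ (reflexive (≡.cong H index))))
      where
      index : n ∸ k ≡ n ∸ i ∸ (k ∸ i)
      index = ≡.trans (≡.cong (n ∸_) (≡.sym (ℕ.m+[n∸m]≡n (ℕ.≤-pred i≤k)))) (≡.sym (ℕ.∸-+-assoc n i (k ∸ i)))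

  ⊛-distribˡ : ∀ F G H → F ⊛ (G ⊕ H) ≋ F ⊛ G ⊕ F ⊛ H
  ⊛-distribˡ F G H n = trans (sumTo-cong (suc n) (λ i → distribˡ _ _ _)) (sumTo-distrib-+ (suc n) _ _)

  ⊛-distribʳ : ∀ F G H → (G ⊕ H) ⊛ F ≋ G ⊛ F ⊕ H ⊛ F
  ⊛-distribʳ F G H n = trans (sumTo-cong (suc n) (λ i → distribʳ _ _ _)) (sumTo-distrib-+ (suc n) _ _)

  ⊛-identityˡ : ∀ F → oneS ⊛ F ≋ F
  ⊛-identityˡ F n = begin
    (oneS ⊛ F) n                                          ≈⟨ sumTo-head n _ ⟩
    1# * F (n ∸ 0) + sumTo n (λ i → 0# * F (n ∸ suc i))    ≈⟨ +-cong (*-identityˡ _) (sumTo-zero n (λ _ _ → zeroˡ _)) ⟩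
    F n + 0#                                              ≈⟨ +-identityʳ _ ⟩
    F n                                                   ∎

  ⊛-identityʳ : ∀ F → F ⊛ oneS ≋ F
  ⊛-identityʳ F n = trans (⊛-comm F oneS n) (⊛-identityˡ F n)

  seriesRing : CommutativeRing c r
  seriesRing = record
    { Carrier = Series ; _≈_ = _≋_ ; _+_ = _⊕_ ; _*_ = _⊛_ ; -_ = λ F n → - F n
    ; 0# = λ _ → 0# ; 1# = oneS
    ; isCommutativeRing = record
      { isRing = record
        { +-isAbelianGroup = Pointwise.isAbelianGroup +-isAbelianGroup
        ; *-cong = ⊛-cong
        ; *-assoc = ⊛-assoc
        ; *-identity = ⊛-identityˡ , ⊛-identityʳ
        ; distrib = ⊛-distribˡ , ⊛-distribʳ }
      ; *-comm = ⊛-comm } }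

  module S = CommutativeRing seriesRing

  ⊕-congˡ : ∀ F {G G′} → G ≋ G′ → F ⊕ G ≋ F ⊕ G′
  ⊕-congˡ F G≋G′ n = +-congˡ (G≋G′ n)

  ⊕-congʳ : ∀ G {F F′} → F ≋ F′ → F ⊕ G ≋ F′ ⊕ G
  ⊕-congʳ G F≋F′ n = +-congʳ (F≋F′ n)

  module ⊛-Solver = Algebra.Solver.Ring.NaturalCoefficients.Default S.commutativeSemiring

module Monomials {c r} (K : CommutativeRing c r) where
  open CommutativeRing K
  open PS K
  open FiniteSums K
  open SeriesRing K
  open import Relation.Binary.Reasoning.Setoid setoid

  tpow-on : ∀ k n → k ≡ n → tpow k n ≈ 1#
  tpow-on k n k≡n with k ℕ.≟ n
  ... | yes _   = refl
  ... | no  k≢n = contradiction k≡n k≢n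

  tpow-diag : ∀ k → tpow k k ≈ 1#
  tpow-diag k = tpow-on k k ≡.refl

  tpow-off : ∀ k n → k ≢ n → tpow k n ≈ 0#
  tpow-off k n k≢n with k ℕ.≟ n
  ... | yes k≡n = contradiction k≡n k≢n
  ... | no  _   = refl

  tpow-⊛-below : ∀ k X n → n < k → (tpow k ⊛ X) n ≈ 0#
  tpow-⊛-below k X n n<k = sumTo-zero (suc n) (λ i i≤n → trans (*-congʳ (tpow-off k i (k≢i i≤n))) (zeroˡ _))
    where
    k≢i : ∀ {i} → i < suc n → k ≢ i
    k≢i i≤n ≡.refl = ℕ.<⇒≱ n<k (ℕ.≤-pred i≤n)

  tpow-⊛-shift : ∀ k X n → (tpow k ⊛ X) (k ℕ.+ n) ≈ X n
  tpow-⊛-shift k X n = begin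
    (tpow k ⊛ X) (k ℕ.+ n)             ≈⟨ sumTo-single (suc (k ℕ.+ n)) k _ (s≤s (ℕ.m≤m+n k n)) off ⟩
    tpow k k * X (k ℕ.+ n ∸ k)         ≈⟨ *-congʳ (tpow-diag k) ⟩
    1# * X (k ℕ.+ n ∸ k)               ≈⟨ *-identityˡ _ ⟩
    X (k ℕ.+ n ∸ k)                    ≡⟨ ≡.cong X (ℕ.m+n∸m≡n k n) ⟩
    X n                                ∎
    where
    off : ∀ i → i < suc (k ℕ.+ n) → i ≢ k → tpow k i * X (k ℕ.+ n ∸ i) ≈ 0#
    off i _ i≢k = trans (*-congʳ (tpow-off k i (i≢k ∘ ≡.sym))) (zeroˡ _)

  tpow-suc : ∀ k n → tpow (suc k) (suc n) ≈ tpow k n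
  tpow-suc k n = case k ℕ.≟ n of λ where
    (yes k≡n) → trans (tpow-on (suc k) (suc n) (≡.cong suc k≡n)) (sym (tpow-on k n k≡n))
    (no  k≢n) → trans (tpow-off (suc k) (suc n) (k≢n ∘ ℕ.suc-injective)) (sym (tpow-off k n k≢n))

  tS-⊛-tpow : ∀ k → tS ⊛ tpow k ≋ tpow (suc k)
  tS-⊛-tpow k zero    = trans (tpow-⊛-below 1 (tpow k) 0 (s≤s z≤n)) (sym (tpow-off (suc k) 0 λ ()))
  tS-⊛-tpow k (suc n) = trans (tpow-⊛-shift 1 (tpow k) n) (sym (tpow-suc k n))

  pow-tS : ∀ k → pow tS k ≋ tpow k
  pow-tS zero    zero    = sym (tpow-diag 0)
  pow-tS zero    (suc n) = sym (tpow-off 0 (suc n) λ ())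
  pow-tS (suc k) = S.trans (⊛-congˡ tS (pow-tS k)) (tS-⊛-tpow k)

  const-vanishes : ∀ k .{{_ : NonZero k}} a n → k ≤ n → const a n ≈ 0#
  const-vanishes k a zero    k≤0 = contradiction k≤0 (ℕ.<⇒≱ (ℕ.>-nonZero⁻¹ k))
  const-vanishes k a (suc n) _   = refl

  ≋-⊕-tpow-⊛ : ∀ k {C L Y : Series} → (∀ n → n < k → C n ≈ L n) → (∀ n → k ≤ n → L n ≈ 0#) →
             (∀ n → C (n ℕ.+ k) ≈ Y n) → C ≋ L ⊕ tpow k ⊛ Y
  ≋-⊕-tpow-⊛ k {C} {L} {Y} low L-high high n with n ℕ.<? k
  ... | yes n<k = begin
    C n                      ≈⟨ low n n<k ⟩
    L n                      ≈⟨ +-identityʳ _ ⟨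
    L n + 0#                 ≈⟨ +-congˡ (tpow-⊛-below k Y n n<k) ⟨
    L n + (tpow k ⊛ Y) n     ∎
  ... | no n≮k = begin
    C n                          ≡⟨ ≡.cong C (ℕ.m∸n+n≡m k≤n) ⟨
    C (n ∸ k ℕ.+ k)              ≈⟨ high (n ∸ k) ⟩
    Y (n ∸ k)                    ≈⟨ tpow-⊛-shift k Y (n ∸ k) ⟨
    (tpow k ⊛ Y) (k ℕ.+ (n ∸ k)) ≡⟨ ≡.cong (tpow k ⊛ Y) (ℕ.m+[n∸m]≡n k≤n) ⟩
    (tpow k ⊛ Y) n               ≈⟨ +-identityˡ _ ⟨
    0# + (tpow k ⊛ Y) n          ≈⟨ +-congʳ (L-high n k≤n) ⟨
    L n + (tpow k ⊛ Y) n         ∎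
    where
    k≤n : k ≤ n
    k≤n = ℕ.≮⇒≥ n≮k

  ≋-tpow-⊛ : ∀ k {C Y : Series} → (∀ n → n < k → C n ≈ 0#) → (∀ n → C (n ℕ.+ k) ≈ Y n) → C ≋ tpow k ⊛ Y
  ≋-tpow-⊛ k {C} {Y} low high = S.trans (≋-⊕-tpow-⊛ k low (λ _ _ → refl) high) (S.+-identityˡ (tpow k ⊛ Y))

  ·ₛ-≋-const-⊛ : ∀ a X → a ·ₛ X ≋ const a ⊛ X
  ·ₛ-≋-const-⊛ a X n = sym (begin
    (const a ⊛ X) n                                  ≈⟨ sumTo-head n _ ⟩
    a * X (n ∸ 0) + sumTo n (λ i → 0# * X (n ∸ suc i)) ≈⟨ +-congˡ (sumTo-zero n (λ _ _ → zeroˡ _)) ⟩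
    a * X n + 0#                                     ≈⟨ +-identityʳ _ ⟩
    a * X n                                          ∎)

  ·ₛ-cong : ∀ a {X Y} → X ≋ Y → a ·ₛ X ≋ a ·ₛ Y
  ·ₛ-cong a X≋Y n = *-congˡ (X≋Y n)

  const-cong : ∀ {a b} → a ≈ b → const a ≋ const b
  const-cong a≈b zero    = a≈b
  const-cong a≈b (suc n) = refl

  const-⊛-const : ∀ a b → const a ⊛ const b ≋ const (a * b)
  const-⊛-const a b = S.trans (S.sym (·ₛ-≋-const-⊛ a (const b))) a·const
    where
    a·const : a ·ₛ const b ≋ const (a * b)
    a·const zero    = refl
    a·const (suc n) = zeroʳ a

module Order {c r} (K : CommutativeRing c r) where
  open CommutativeRing K
  open PS K
  open FiniteSums K
  open SeriesRing K
  open import Relation.Binary.Reasoning.Setoid setoid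

  VanishesBelow : ℕ → Series → Set r
  VanishesBelow k X = ∀ n → n < k → X n ≈ 0#

  vanishesBelow-1 : ∀ {X} → X 0 ≈ 0# → VanishesBelow 1 X
  vanishesBelow-1 X₀≈0 zero    _ = X₀≈0
  vanishesBelow-1 X₀≈0 (suc n) (s≤s ())

  vanishesBelow-0 : ∀ X → VanishesBelow 0 X
  vanishesBelow-0 X n ()

  private
    m∸n<o : ∀ {m n o} → n ≤ m → m < n ℕ.+ o → m ∸ n < o
    m∸n<o {m} {n} {o} n≤m m<n+o =
      ℕ.+-cancelˡ-< n (m ∸ n) o (≡.subst (ℕ._< n ℕ.+ o) (≡.sym (ℕ.m+[n∸m]≡n n≤m)) m<n+o)

  vanishesBelow-⊛ : ∀ a b {X Y} → VanishesBelow a X → VanishesBelow b Y → VanishesBelow (a ℕ.+ b) (X ⊛ Y)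
  vanishesBelow-⊛ a b {X} {Y} X≈0 Y≈0 n n<a+b = sumTo-zero (suc n) term≈0
    where
    term≈0 : ∀ i → i < suc n → X i * Y (n ∸ i) ≈ 0#
    term≈0 i i≤n with i ℕ.<? a
    ... | yes i<a = trans (*-congʳ (X≈0 i i<a)) (zeroˡ _)
    ... | no  i≮a = trans (*-congˡ (Y≈0 (n ∸ i) (m∸n<o (ℕ.≤-pred i≤n) n<i+b))) (zeroʳ _)
      where
      n<i+b : n < i ℕ.+ b
      n<i+b = ℕ.<-≤-trans n<a+b (ℕ.+-monoˡ-≤ b (ℕ.≮⇒≥ i≮a))

  ⊛-leading : ∀ a b {X Y} → VanishesBelow a X → VanishesBelow b Y → (X ⊛ Y) (a ℕ.+ b) ≈ X a * Y b
  ⊛-leading a b {X} {Y} X≈0 Y≈0 = begin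
    (X ⊛ Y) (a ℕ.+ b)        ≈⟨ sumTo-single (suc (a ℕ.+ b)) a _ (s≤s (ℕ.m≤m+n a b)) term≈0 ⟩
    X a * Y (a ℕ.+ b ∸ a)    ≡⟨ ≡.cong (λ j → X a * Y j) (ℕ.m+n∸m≡n a b) ⟩
    X a * Y b                ∎
    where
    term≈0 : ∀ i → i < suc (a ℕ.+ b) → i ≢ a → X i * Y (a ℕ.+ b ∸ i) ≈ 0#
    term≈0 i i≤a+b i≢a with i ℕ.<? a
    ... | yes i<a = trans (*-congʳ (X≈0 i i<a)) (zeroˡ _)
    ... | no  i≮a = trans (*-congˡ (Y≈0 _ (m∸n<o (ℕ.≤-pred i≤a+b) a+b<i+b))) (zeroʳ _)
      where
      a+b<i+b : a ℕ.+ b < i ℕ.+ b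
      a+b<i+b = ℕ.+-monoˡ-< b (ℕ.≤∧≢⇒< (ℕ.≮⇒≥ i≮a) (i≢a ∘ ≡.sym))

  vanishesBelow-pow : ∀ k {H} → VanishesBelow 1 H → VanishesBelow k (pow H k)
  vanishesBelow-pow zero    H≈0 = vanishesBelow-0 _
  vanishesBelow-pow (suc k) H≈0 = vanishesBelow-⊛ 1 k H≈0 (vanishesBelow-pow k H≈0)

  MonomialBelow : ℕ → ℕ → Series → Set r
  MonomialBelow L ρ X = ∀ n → n < L → n ≢ ρ → X n ≈ 0#

  monomialBelow-⊛ : ∀ L ρ σ {X Y} → MonomialBelow L ρ X → MonomialBelow L σ Y → MonomialBelow L (ρ ℕ.+ σ) (X ⊛ Y)
  monomialBelow-⊛ L ρ σ {X} {Y} X≈0 Y≈0 n n<L n≢ρ+σ = sumTo-zero (suc n) term≈0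
    where
    term≈0 : ∀ i → i < suc n → X i * Y (n ∸ i) ≈ 0#
    term≈0 i i≤n with i ℕ.≟ ρ
    ... | no  i≢ρ    = trans (*-congʳ (X≈0 i (ℕ.≤-<-trans (ℕ.≤-pred i≤n) n<L) i≢ρ)) (zeroˡ _)
    ... | yes ≡.refl = trans (*-congˡ (Y≈0 (n ∸ i) (ℕ.≤-<-trans (ℕ.m∸n≤m n i) n<L) n∸i≢σ)) (zeroʳ _)
      where
      n∸i≢σ : n ∸ i ≢ σ
      n∸i≢σ n∸i≡σ = n≢ρ+σ (≡.trans (≡.sym (ℕ.m+[n∸m]≡n (ℕ.≤-pred i≤n))) (≡.cong (i ℕ.+_) n∸i≡σ))

  monomialBelow-oneS : ∀ L → MonomialBelow L 0 oneS
  monomialBelow-oneS L zero    _ 0≢0 = contradiction ≡.refl 0≢0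
  monomialBelow-oneS L (suc n) _ _   = refl

  pow-+ : ∀ a b F → pow F (a ℕ.+ b) ≋ pow F a ⊛ pow F b
  pow-+ zero    b F = S.sym (⊛-identityˡ (pow F b))
  pow-+ (suc a) b F = S.trans (⊛-congˡ F (pow-+ a b F)) (S.sym (⊛-assoc F (pow F a) (pow F b)))

  pow-* : ∀ a b F → pow F (a ℕ.* b) ≋ pow (pow F a) b
  pow-* a zero    F rewrite ℕ.*-zeroʳ a = S.refl
  pow-* a (suc b) F rewrite ℕ.*-suc a b = S.trans (pow-+ a (a ℕ.* b) F) (⊛-congˡ (pow F a) (pow-* a b F))

  pow-cong : ∀ k {F G} → F ≋ G → pow F k ≋ pow G k
  pow-cong zero    F≋G = S.refl
  pow-cong (suc k) F≋G = ⊛-cong F≋G (pow-cong k F≋G)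

  prodS-cong : ∀ m {X Y} → AllUpTo m (λ i → X i ≋ Y i) → prodS m X ≋ prodS m Y
  prodS-cong zero    X≋Y = S.refl
  prodS-cong (suc m) X≋Y = ⊛-cong (prodS-cong m (allUpTo-init X≋Y)) (allUpTo-last X≋Y)

  prodS-⊛ : ∀ m X Y → prodS m (λ i → X i ⊛ Y i) ≋ prodS m X ⊛ prodS m Y
  prodS-⊛ zero    X Y = S.sym (⊛-identityˡ oneS)
  prodS-⊛ (suc m) X Y = S.trans (⊛-congʳ (X (suc m) ⊛ Y (suc m)) (prodS-⊛ m X Y))
                                (interchange (prodS m X) (prodS m Y) (X (suc m)) (Y (suc m)))
    where open import Algebra.Properties.CommutativeSemigroup S.*-commutativeSemigroup using (interchange)

  prodS-oneS : ∀ m → prodS m (λ _ → oneS) ≋ oneS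
  prodS-oneS zero    = S.refl
  prodS-oneS (suc m) = S.trans (⊛-identityʳ _) (prodS-oneS m)

  prodS-pow : ∀ m X j → prodS m (λ i → pow (X i) j) ≋ pow (prodS m X) j
  prodS-pow m X zero    = prodS-oneS m
  prodS-pow m X (suc j) = S.trans (prodS-⊛ m X (λ i → pow (X i) j)) (⊛-congˡ (prodS m X) (prodS-pow m X j))

  prodS-oneS-tail : ∀ {m n} X → m ℕ.≤′ n → (∀ i → m < i → i ≤ n → X i ≋ oneS) → prodS n X ≋ prodS m X
  prodS-oneS-tail X ℕ.≤′-refl          _    = S.refl
  prodS-oneS-tail X (ℕ.≤′-step m≤′n) ones =
    S.trans (⊛-cong (prodS-oneS-tail X m≤′n (λ i m<i i≤n → ones i m<i (ℕ.m≤n⇒m≤1+n i≤n)))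
                    (ones _ (s≤s (ℕ.≤′⇒≤ m≤′n)) ℕ.≤-refl))
            (⊛-identityʳ _)

  vanishesBelow-prodS : ∀ m X → AllUpTo m (λ i → VanishesBelow 1 (X i)) → VanishesBelow m (prodS m X)
  vanishesBelow-prodS zero    X X≈0 = vanishesBelow-0 _
  vanishesBelow-prodS (suc m) X X≈0 = ≡.subst (λ k → VanishesBelow k (prodS (suc m) X)) (ℕ.+-comm m 1) $
    vanishesBelow-⊛ m 1 (vanishesBelow-prodS m X (allUpTo-init X≈0)) (allUpTo-last X≈0)

  prodS-leading : ∀ m X → AllUpTo m (λ i → VanishesBelow 1 (X i)) → prodS m X m ≈ prodC m (λ i → X i 1)
  prodS-leading zero    X X≈0 = refl
  prodS-leading (suc m) X X≈0 = begin
    prodS (suc m) X (suc m)            ≡⟨ ≡.cong (prodS (suc m) X) (ℕ.+-comm 1 m) ⟩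
    prodS (suc m) X (m ℕ.+ 1)          ≈⟨ ⊛-leading m 1 (vanishesBelow-prodS m X (allUpTo-init X≈0)) (allUpTo-last X≈0) ⟩
    prodS m X m * X (suc m) 1          ≈⟨ *-congʳ (prodS-leading m X (allUpTo-init X≈0)) ⟩
    prodC (suc m) (λ i → X i 1)        ∎

  monomialBelow-prodS : ∀ L m X → AllUpTo m (λ i → MonomialBelow L 1 (X i)) → MonomialBelow L m (prodS m X)
  monomialBelow-prodS L zero    X X≈0 = monomialBelow-oneS L
  monomialBelow-prodS L (suc m) X X≈0 = ≡.subst (λ ρ → MonomialBelow L ρ (prodS (suc m) X)) (ℕ.+-comm m 1) $
    monomialBelow-⊛ L m 1 (monomialBelow-prodS L m X (allUpTo-init X≈0)) (allUpTo-last X≈0)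

module Cancellation {c r} (K : CommutativeRing c r) where
  open CommutativeRing K
  open PS K
  open FiniteSums K
  open SeriesRing K
  open Monomials K
  open import Relation.Binary.Reasoning.Setoid setoid
  open import Data.Nat.Induction using (<-rec)
  open import Algebra.Properties.Ring S.ring using (x[y-z]≈xy-xz; x≈y⇒x∙y⁻¹≈ε; x∙y⁻¹≈ε⇒x≈y)

  unit-⊛-≋0⇒≋0 : ∀ V {y} → V 0 * y ≈ 1# → ∀ {D} → V ⊛ D ≋ S.0# → D ≋ S.0#
  unit-⊛-≋0⇒≋0 V {y} V₀y≈1 {D} VD≈0 = <-rec (λ i → D i ≈ 0#) step
    where
    step : ∀ i → (∀ {j} → j < i → D j ≈ 0#) → D i ≈ 0#
    step i lower≈0 = begin
      D i                   ≈⟨ *-identityʳ _ ⟨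
      D i * 1#              ≈⟨ *-congˡ V₀y≈1 ⟨
      D i * (V 0 * y)       ≈⟨ *-assoc _ _ _ ⟨
      D i * V 0 * y         ≈⟨ *-congʳ DiV₀≈0 ⟩
      0# * y                ≈⟨ zeroˡ y ⟩
      0#                    ∎
      where
      DiV₀≈0 : D i * V 0 ≈ 0#
      DiV₀≈0 = begin
        D i * V 0                          ≈⟨ +-identityˡ _ ⟨
        0# + D i * V 0                     ≈⟨ +-cong (sumTo-zero i (λ j j<i → trans (*-congʳ (lower≈0 j<i)) (zeroˡ _)))
                                                     (reflexive (≡.cong (λ k → D i * V k) (ℕ.n∸n≡0 i))) ⟨
        (D ⊛ V) i                          ≈⟨ ⊛-comm D V i ⟩
        (V ⊛ D) i                          ≈⟨ VD≈0 i ⟩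
        0#                                 ∎

  ⊛-cancelˡ-unit : ∀ V {y} → V 0 * y ≈ 1# → ∀ {X Y} → V ⊛ X ≋ V ⊛ Y → X ≋ Y
  ⊛-cancelˡ-unit V V₀y≈1 {X} {Y} VX≋VY =
    x∙y⁻¹≈ε⇒x≈y X Y (unit-⊛-≋0⇒≋0 V V₀y≈1 (S.trans (x[y-z]≈xy-xz V X Y) (x≈y⇒x∙y⁻¹≈ε VX≋VY)))

  tS-⊛-cancelˡ : ∀ {X Y} → tS ⊛ X ≋ tS ⊛ Y → X ≋ Y
  tS-⊛-cancelˡ {X} {Y} tX≋tY n = trans (sym (tpow-⊛-shift 1 X n)) (trans (tX≋tY (suc n)) (tpow-⊛-shift 1 Y n))

  ≋-tS-⊛-shift : ∀ {X} → X 0 ≈ 0# → X ≋ tS ⊛ (λ n → X (suc n))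
  ≋-tS-⊛-shift {X} X₀≈0 zero    = trans X₀≈0 (sym (tpow-⊛-below 1 (λ n → X (suc n)) 0 (s≤s z≤n)))
  ≋-tS-⊛-shift {X} X₀≈0 (suc n) = sym (tpow-⊛-shift 1 (λ n → X (suc n)) n)

  ⊛-cancelˡ-order1 : ∀ V {y} → V 0 ≈ 0# → V 1 * y ≈ 1# → ∀ {X Y} → V ⊛ X ≋ V ⊛ Y → X ≋ Y
  ⊛-cancelˡ-order1 V V₀≈0 V₁y≈1 {X} {Y} VX≋VY =
    ⊛-cancelˡ-unit V′ V₁y≈1 (tS-⊛-cancelˡ (S.trans (unshift X) (S.trans VX≋VY (S.sym (unshift Y)))))
    where
    V′ : Series
    V′ n = V (suc n)
    unshift : ∀ Z → tS ⊛ (V′ ⊛ Z) ≋ V ⊛ Z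
    unshift Z = S.trans (S.sym (⊛-assoc tS V′ Z)) (⊛-congʳ Z (S.sym (≋-tS-⊛-shift V₀≈0)))

module Composition {c r} (K : CommutativeRing c r) where
  open CommutativeRing K
  open PS K
  open FiniteSums K
  open SeriesRing K
  open Monomials K
  open Order K
  open import Relation.Binary.Reasoning.Setoid setoid
  open import Algebra.Properties.CommutativeSemigroup *-commutativeSemigroup using (interchange)

  comp-cong : ∀ {F F′ H H′} → F ≋ F′ → H ≋ H′ → comp F H ≋ comp F′ H′
  comp-cong F≋F′ H≋H′ n = sumTo-cong (suc n) (λ k → *-cong (F≋F′ k) (pow-cong k H≋H′ n))

  comp-congˡ : ∀ {F F′} H → F ≋ F′ → comp F H ≋ comp F′ H
  comp-congˡ H F≋F′ = comp-cong F≋F′ (λ _ → refl)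

  comp-const : ∀ a H → comp (const a) H ≋ const a
  comp-const a H n = begin
    comp (const a) H n                                        ≈⟨ sumTo-head n _ ⟩
    a * oneS n + sumTo n (λ k → 0# * pow H (suc k) n)         ≈⟨ +-cong (a*oneS n) (sumTo-zero n (λ _ _ → zeroˡ _)) ⟩
    const a n + 0#                                            ≈⟨ +-identityʳ _ ⟩
    const a n                                                 ∎
    where
    a*oneS : ∀ n → a * oneS n ≈ const a n
    a*oneS zero    = *-identityʳ a
    a*oneS (suc n) = zeroʳ a

  comp-coeff-0 : ∀ F H → comp F H 0 ≈ F 0
  comp-coeff-0 F H = trans (+-identityˡ _) (*-identityʳ _)

  comp-coeff-1 : ∀ F H → comp F H 1 ≈ F 1 * H 1
  comp-coeff-1 F H = begin
    0# + F 0 * 0# + F 1 * (H ⊛ oneS) 1   ≈⟨ +-cong (trans (+-identityˡ _) (zeroʳ _)) (*-congˡ (⊛-identityʳ H 1)) ⟩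
    0# + F 1 * H 1                       ≈⟨ +-identityˡ _ ⟩
    F 1 * H 1                            ∎

  comp-⊕ : ∀ F G H → comp (F ⊕ G) H ≋ comp F H ⊕ comp G H
  comp-⊕ F G H n = trans (sumTo-cong (suc n) (λ k → distribʳ _ _ _)) (sumTo-distrib-+ (suc n) _ _)

  comp-·ₛ : ∀ a F H → comp (a ·ₛ F) H ≋ a ·ₛ comp F H
  comp-·ₛ a F H n = trans (sumTo-cong (suc n) (λ k → *-assoc _ _ _)) (sym (*-distribˡ-sumTo (suc n) a _))

  comp-tS : ∀ F → comp F tS ≋ F
  comp-tS F n = begin
    comp F tS n          ≈⟨ sumTo-single (suc n) n _ ℕ.≤-refl (λ k _ k≢n → trans (*-congˡ (pow-tS-off k k≢n)) (zeroʳ _)) ⟩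
    F n * pow tS n n     ≈⟨ *-congˡ (trans (pow-tS n n) (tpow-diag n)) ⟩
    F n * 1#             ≈⟨ *-identityʳ _ ⟩
    F n                  ∎
    where
    pow-tS-off : ∀ k → k ≢ n → pow tS k n ≈ 0#
    pow-tS-off k k≢n = trans (pow-tS k n) (tpow-off k n k≢n)

  comp-truncate : ∀ {H} → VanishesBelow 1 H → ∀ F n N → n < N → comp F H n ≈ sumTo N (λ k → F k * pow H k n)
  comp-truncate H₀≈0 F n N n<N = sumTo-extend (suc n) N _ n<N
    (λ k n<k _ → trans (*-congˡ (vanishesBelow-pow k H₀≈0 n n<k)) (zeroʳ _))

  module _ {H : Series} (H₀≈0 : VanishesBelow 1 H) where

    comp-tpow : ∀ k → comp (tpow k) H ≋ pow H k
    comp-tpow k n with k ℕ.≤? n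
    ... | yes k≤n = begin
      comp (tpow k) H n          ≈⟨ sumTo-single (suc n) k _ (s≤s k≤n)
                                      (λ i _ i≢k → trans (*-congʳ (tpow-off k i (i≢k ∘ ≡.sym))) (zeroˡ _)) ⟩
      tpow k k * pow H k n       ≈⟨ *-congʳ (tpow-diag k) ⟩
      1# * pow H k n             ≈⟨ *-identityˡ _ ⟩
      pow H k n                  ∎
    ... | no  k≰n = begin
      comp (tpow k) H n          ≈⟨ sumTo-zero (suc n)
                                      (λ i i≤n → trans (*-congʳ (tpow-off k i λ { ≡.refl → k≰n (ℕ.≤-pred i≤n) })) (zeroˡ _)) ⟩
      0#                         ≈⟨ vanishesBelow-pow k H₀≈0 n (ℕ.≰⇒> k≰n) ⟨
      pow H k n                  ∎

    comp-⊛ : ∀ F G → comp (F ⊛ G) H ≋ comp F H ⊛ comp G H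
    comp-⊛ F G n = trans comp-⊛≈double-sum (sym ⊛-comp≈double-sum)
      where
      X : ℕ → ℕ → Carrier
      X a b = (F a * G b) * pow H (a ℕ.+ b) n

      comp-⊛≈double-sum : comp (F ⊛ G) H n ≈ sumTo (suc n) (λ a → sumTo (suc n) (λ b → (F a * G b) * (pow H a ⊛ pow H b) n))
      comp-⊛≈double-sum = begin
        sumTo (suc n) (λ k → sumTo (suc k) (λ a → F a * G (k ∸ a)) * pow H k n)
          ≈⟨ sumTo-cong (suc n) (λ k → trans (*-distribʳ-sumTo (suc k) _ _) (sumTo-cong-< (suc k) (reindex k))) ⟩
        sumTo (suc n) (λ k → sumTo (suc k) (λ a → X a (k ∸ a)))
          ≈⟨ sumTo-triangle n X ⟩
        sumTo (suc n) (λ a → sumTo (suc (n ∸ a)) (λ b → X a b))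
          ≈⟨ sumTo-cong-< (suc n) (λ a a≤n →
               sumTo-extend (suc (n ∸ a)) (suc n) (X a) (s≤s (ℕ.m∸n≤m n a)) (X≈0 a (ℕ.≤-pred a≤n))) ⟩
        sumTo (suc n) (λ a → sumTo (suc n) (λ b → X a b))
          ≈⟨ sumTo-cong (suc n) (λ a → sumTo-cong (suc n) (λ b → *-congˡ (pow-+ a b H n))) ⟩
        sumTo (suc n) (λ a → sumTo (suc n) (λ b → (F a * G b) * (pow H a ⊛ pow H b) n)) ∎
        where
        reindex : ∀ k a → a < suc k → F a * G (k ∸ a) * pow H k n ≈ X a (k ∸ a)
        reindex k a a≤k = *-congˡ (reflexive (≡.cong (λ e → pow H e n) (≡.sym (ℕ.m+[n∸m]≡n (ℕ.≤-pred a≤k)))))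
        X≈0 : ∀ a → a ≤ n → ∀ b → suc (n ∸ a) ≤ b → b < suc n → X a b ≈ 0#
        X≈0 a a≤n b n∸a<b _ = trans (*-congˡ (vanishesBelow-pow (a ℕ.+ b) H₀≈0 n n<a+b)) (zeroʳ _)
          where
          n<a+b : n < a ℕ.+ b
          n<a+b = ≡.subst (ℕ._< a ℕ.+ b) (ℕ.m+[n∸m]≡n a≤n) (ℕ.+-monoʳ-< a n∸a<b)

      ⊛-comp≈double-sum : (comp F H ⊛ comp G H) n ≈ sumTo (suc n) (λ a → sumTo (suc n) (λ b → (F a * G b) * (pow H a ⊛ pow H b) n))
      ⊛-comp≈double-sum = begin
        sumTo (suc n) (λ i → comp F H i * comp G H (n ∸ i))
          ≈⟨ sumTo-cong-< (suc n) (λ i i≤n → *-cong (comp-truncate H₀≈0 F i (suc n) i≤n)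
                                                    (comp-truncate H₀≈0 G (n ∸ i) (suc n) (s≤s (ℕ.m∸n≤m n i)))) ⟩
        sumTo (suc n) (λ i → sumTo (suc n) (λ a → F a * pow H a i) * sumTo (suc n) (λ b → G b * pow H b (n ∸ i)))
          ≈⟨ sumTo-cong (suc n) (λ i → trans (*-distribʳ-sumTo (suc n) _ _) (sumTo-cong (suc n) (λ a → *-distribˡ-sumTo (suc n) _ _))) ⟩
        sumTo (suc n) (λ i → sumTo (suc n) (λ a → sumTo (suc n) (λ b → (F a * pow H a i) * (G b * pow H b (n ∸ i)))))
          ≈⟨ sumTo-comm (suc n) (suc n) _ ⟩
        sumTo (suc n) (λ a → sumTo (suc n) (λ i → sumTo (suc n) (λ b → (F a * pow H a i) * (G b * pow H b (n ∸ i)))))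
          ≈⟨ sumTo-cong (suc n) (λ a → sumTo-comm (suc n) (suc n) _) ⟩
        sumTo (suc n) (λ a → sumTo (suc n) (λ b → sumTo (suc n) (λ i → (F a * pow H a i) * (G b * pow H b (n ∸ i)))))
          ≈⟨ sumTo-cong (suc n) (λ a → sumTo-cong (suc n) (λ b →
               trans (sumTo-cong (suc n) (λ i → interchange _ _ _ _)) (sym (*-distribˡ-sumTo (suc n) _ _)))) ⟩
        sumTo (suc n) (λ a → sumTo (suc n) (λ b → (F a * G b) * (pow H a ⊛ pow H b) n)) ∎

    comp-pow : ∀ F k → comp (pow F k) H ≋ pow (comp F H) k
    comp-pow F zero    = comp-const 1# H
    comp-pow F (suc k) = S.trans (comp-⊛ F (pow F k)) (⊛-congˡ (comp F H) (comp-pow F k))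

    comp-prodS : ∀ m X → comp (prodS m X) H ≋ prodS m (λ i → comp (X i) H)
    comp-prodS zero    X = comp-const 1# H
    comp-prodS (suc m) X = S.trans (comp-⊛ (prodS m X) (X (suc m))) (⊛-congʳ (comp (X (suc m)) H) (comp-prodS m X))

    comp-assoc : ∀ {G} → VanishesBelow 1 G → ∀ F → comp (comp F G) H ≋ comp F (comp G H)
    comp-assoc {G} G₀≈0 F n = begin
      sumTo (suc n) (λ k → comp F G k * pow H k n)
        ≈⟨ sumTo-cong-< (suc n) (λ k k≤n → trans (*-congʳ (comp-truncate G₀≈0 F k (suc n) k≤n)) (*-distribʳ-sumTo (suc n) _ _)) ⟩
      sumTo (suc n) (λ k → sumTo (suc n) (λ j → (F j * pow G j k) * pow H k n))
        ≈⟨ sumTo-comm (suc n) (suc n) _ ⟩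
      sumTo (suc n) (λ j → sumTo (suc n) (λ k → (F j * pow G j k) * pow H k n))
        ≈⟨ sumTo-cong (suc n) (λ j → trans (sumTo-cong (suc n) (λ k → *-assoc _ _ _)) (sym (*-distribˡ-sumTo (suc n) _ _))) ⟩
      sumTo (suc n) (λ j → F j * comp (pow G j) H n)
        ≈⟨ sumTo-cong (suc n) (λ j → *-congˡ (comp-pow G j n)) ⟩
      comp F (comp G H) n ∎

module Spread {c r} (K : CommutativeRing c r) (ℓ : ℕ) .{{_ : NonZero ℓ}} where
  open CommutativeRing K
  open PS K
  open FiniteSums K
  open SeriesRing K
  open Monomials K
  open Order K
  open Composition K
  open import Relation.Binary.Reasoning.Setoid setoid
  open import Data.Nat.Divisibility using (_∣_; _∣?_; divides; >⇒∤; ∣m+n∣m⇒∣n; n∣m*n; ∣-refl)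
  open import Algebra.Properties.CommutativeSemigroup *-commutativeSemigroup using (x∙yz≈y∙xz)

  spread-multiple : ∀ s q → spread ℓ s (q ℕ.* ℓ) ≈ s q
  spread-multiple s q with ℓ ∣? q ℕ.* ℓ
  ... | yes (divides q′ q*ℓ≡q′*ℓ) = reflexive (≡.cong s (≡.sym (ℕ.*-cancelʳ-≡ q q′ ℓ q*ℓ≡q′*ℓ)))
  ... | no  ℓ∤q*ℓ               = contradiction (n∣m*n q) ℓ∤q*ℓ

  spread-nonmultiple : ∀ s n → ¬ ℓ ∣ n → spread ℓ s n ≈ 0#
  spread-nonmultiple s n ℓ∤n with ℓ ∣? n
  ... | yes ℓ∣n = contradiction ℓ∣n ℓ∤n
  ... | no  _   = refl

  sumTo-spread : ∀ s (X : ℕ → Carrier) M →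
    sumTo (M ℕ.* ℓ) (λ k → spread ℓ s k * X k) ≈ sumTo M (λ q → s q * X (q ℕ.* ℓ))
  sumTo-spread s X zero    = refl
  sumTo-spread s X (suc M) = begin
    sumTo (ℓ ℕ.+ M ℕ.* ℓ) (λ k → spread ℓ s k * X k)
      ≈⟨ sumTo-split (M ℕ.* ℓ) ℓ _ ⟩
    sumTo (M ℕ.* ℓ) (λ k → spread ℓ s k * X k) + sumTo ℓ (λ i → spread ℓ s (i ℕ.+ M ℕ.* ℓ) * X (i ℕ.+ M ℕ.* ℓ))
      ≈⟨ +-cong (sumTo-spread s X M) (sumTo-single ℓ 0 _ (ℕ.>-nonZero⁻¹ ℓ) off-multiple) ⟩
    sumTo M (λ q → s q * X (q ℕ.* ℓ)) + spread ℓ s (M ℕ.* ℓ) * X (M ℕ.* ℓ)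
      ≈⟨ +-congˡ (*-congʳ (spread-multiple s M)) ⟩
    sumTo (suc M) (λ q → s q * X (q ℕ.* ℓ)) ∎
    where
    off-multiple : ∀ i → i < ℓ → i ≢ 0 → spread ℓ s (i ℕ.+ M ℕ.* ℓ) * X (i ℕ.+ M ℕ.* ℓ) ≈ 0#
    off-multiple zero    _   0≢0 = contradiction ≡.refl 0≢0
    off-multiple (suc i) i<ℓ _   = trans (*-congʳ (spread-nonmultiple s _ (>⇒∤ i<ℓ ∘ ∣i+Mℓ⇒∣i))) (zeroˡ _)
      where
      ∣i+Mℓ⇒∣i : ℓ ∣ suc i ℕ.+ M ℕ.* ℓ → ℓ ∣ suc i
      ∣i+Mℓ⇒∣i ℓ∣ = ∣m+n∣m⇒∣n (≡.subst (ℓ ∣_) (ℕ.+-comm (suc i) (M ℕ.* ℓ)) ℓ∣) (n∣m*n M)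

  module _ {H : Series} (H₀≈0 : VanishesBelow 1 H) where

    comp-spread : ∀ s n m → m ≤ n → comp (spread ℓ s) H m ≈ sumTo (suc n) (λ j → s j * pow H (ℓ ℕ.* j) m)
    comp-spread s n m m≤n = begin
      comp (spread ℓ s) H m
        ≈⟨ comp-truncate H₀≈0 (spread ℓ s) m (suc n ℕ.* ℓ) (ℕ.<-≤-trans (s≤s m≤n) (ℕ.m≤m*n (suc n) ℓ)) ⟩
      sumTo (suc n ℕ.* ℓ) (λ k → spread ℓ s k * pow H k m)
        ≈⟨ sumTo-spread s (λ k → pow H k m) (suc n) ⟩
      sumTo (suc n) (λ j → s j * pow H (j ℕ.* ℓ) m)
        ≈⟨ sumTo-cong (suc n) (λ j → reflexive (≡.cong (λ e → s j * pow H e m) (ℕ.*-comm j ℓ))) ⟩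
      sumTo (suc n) (λ j → s j * pow H (ℓ ℕ.* j) m) ∎

    ⊛-comp-spread : ∀ s B n → (B ⊛ comp (spread ℓ s) H) n ≈ sumTo (suc n) (λ j → s j * (B ⊛ pow H (ℓ ℕ.* j)) n)
    ⊛-comp-spread s B n = begin
      sumTo (suc n) (λ i → B i * comp (spread ℓ s) H (n ∸ i))
        ≈⟨ sumTo-cong (suc n) (λ i → *-congˡ (comp-spread s n (n ∸ i) (ℕ.m∸n≤m n i))) ⟩
      sumTo (suc n) (λ i → B i * sumTo (suc n) (λ j → s j * pow H (ℓ ℕ.* j) (n ∸ i)))
        ≈⟨ sumTo-cong (suc n) (λ i → trans (*-distribˡ-sumTo (suc n) _ _) (sumTo-cong (suc n) (λ j → x∙yz≈y∙xz _ _ _))) ⟩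
      sumTo (suc n) (λ i → sumTo (suc n) (λ j → s j * (B i * pow H (ℓ ℕ.* j) (n ∸ i))))
        ≈⟨ sumTo-comm (suc n) (suc n) _ ⟩
      sumTo (suc n) (λ j → sumTo (suc n) (λ i → s j * (B i * pow H (ℓ ℕ.* j) (n ∸ i))))
        ≈⟨ sumTo-cong (suc n) (λ j → *-distribˡ-sumTo (suc n) (s j) _) ⟨
      sumTo (suc n) (λ j → s j * (B ⊛ pow H (ℓ ℕ.* j)) n) ∎

  spread-head : ∀ s → spread ℓ s ≋ const (s 0) ⊕ tpow ℓ ⊛ spread ℓ (λ j → s (suc j))
  spread-head s = ≋-⊕-tpow-⊛ ℓ low (const-vanishes ℓ (s 0)) shifted
    where
    low : ∀ n → n < ℓ → spread ℓ s n ≈ const (s 0) n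
    low zero    _   = spread-multiple s 0
    low (suc n) n<ℓ = spread-nonmultiple s (suc n) (>⇒∤ n<ℓ)
    shifted : ∀ n → spread ℓ s (n ℕ.+ ℓ) ≈ spread ℓ (λ j → s (suc j)) n
    shifted n with ℓ ∣? n
    ... | yes (divides q n≡q*ℓ) = trans (reflexive (≡.cong (spread ℓ s) n+ℓ≡[1+q]*ℓ)) (spread-multiple s (suc q))
      where
      n+ℓ≡[1+q]*ℓ : n ℕ.+ ℓ ≡ suc q ℕ.* ℓ
      n+ℓ≡[1+q]*ℓ = ≡.trans (≡.cong (ℕ._+ ℓ) n≡q*ℓ) (ℕ.+-comm (q ℕ.* ℓ) ℓ)
    ... | no  ℓ∤n =
      spread-nonmultiple s (n ℕ.+ ℓ) (λ ℓ∣n+ℓ → ℓ∤n (∣m+n∣m⇒∣n (≡.subst (ℓ ∣_) (ℕ.+-comm n ℓ) ℓ∣n+ℓ) ∣-refl))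

-- expo is declared in PS K but does not depend on K.
module Exponents {c r} (K : CommutativeRing c r) (ℓ : ℕ) .{{_ : NonZero ℓ}} where
  open PS K using (expo)
  open import Data.Nat.DivMod using (_/_; +-distrib-/-∣ʳ; m*n/n≡m; m<n⇒m/n≡0; m/n≡1+[m∸n]/n)
  open import Data.Nat.Divisibility using (n∣m*n)
  open import Data.Nat.Tactic.RingSolver using (solve-∀)
  open ≡.≡-Reasoning

  expo-periodic : ∀ i m j → expo ℓ i (suc m ℕ.+ ℓ ℕ.* j) ≡ expo ℓ i (suc m) ℕ.+ j
  expo-periodic i m j = begin
    (m ℕ.+ ℓ ℕ.* j ℕ.+ (ℓ ∸ i)) / ℓ        ≡⟨ ≡.cong (_/ ℓ) (rearrange m ℓ j (ℓ ∸ i)) ⟩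
    (m ℕ.+ (ℓ ∸ i) ℕ.+ j ℕ.* ℓ) / ℓ        ≡⟨ +-distrib-/-∣ʳ (m ℕ.+ (ℓ ∸ i)) (n∣m*n j) ⟩
    (m ℕ.+ (ℓ ∸ i)) / ℓ ℕ.+ j ℕ.* ℓ / ℓ    ≡⟨ ≡.cong ((m ℕ.+ (ℓ ∸ i)) / ℓ ℕ.+_) (m*n/n≡m j ℓ) ⟩
    expo ℓ i (suc m) ℕ.+ j                 ∎
    where
    rearrange : ∀ m ℓ j x → m ℕ.+ ℓ ℕ.* j ℕ.+ x ≡ m ℕ.+ x ℕ.+ j ℕ.* ℓ
    rearrange = solve-∀

  expo-≡0 : ∀ i m → m < i → i ≤ ℓ → expo ℓ i (suc m) ≡ 0
  expo-≡0 i m m<i i≤ℓ = m<n⇒m/n≡0 (≡.subst (m ℕ.+ (ℓ ∸ i) <_) (ℕ.m+[n∸m]≡n i≤ℓ) (ℕ.+-monoˡ-< (ℓ ∸ i) m<i))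

  expo-≡1 : ∀ i m → i ≤ m → m < ℓ → expo ℓ i (suc m) ≡ 1
  expo-≡1 i m i≤m m<ℓ = begin
    (m ℕ.+ (ℓ ∸ i)) / ℓ          ≡⟨ ≡.cong (_/ ℓ) m+[ℓ∸i]≡ℓ+[m∸i] ⟩
    (ℓ ℕ.+ (m ∸ i)) / ℓ          ≡⟨ m/n≡1+[m∸n]/n (ℕ.m≤m+n ℓ (m ∸ i)) ⟩
    suc ((ℓ ℕ.+ (m ∸ i) ∸ ℓ) / ℓ) ≡⟨ ≡.cong (λ e → suc (e / ℓ)) (ℕ.m+n∸m≡n ℓ (m ∸ i)) ⟩
    suc ((m ∸ i) / ℓ)            ≡⟨ ≡.cong suc (m<n⇒m/n≡0 (ℕ.≤-<-trans (ℕ.m∸n≤m m i) m<ℓ)) ⟩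
    1                            ∎
    where
    m+[ℓ∸i]≡ℓ+[m∸i] : m ℕ.+ (ℓ ∸ i) ≡ ℓ ℕ.+ (m ∸ i)
    m+[ℓ∸i]≡ℓ+[m∸i] = begin
      m ℕ.+ (ℓ ∸ i)              ≡⟨ ℕ.+-∸-assoc m (ℕ.≤-trans i≤m (ℕ.<⇒≤ m<ℓ)) ⟨
      m ℕ.+ ℓ ∸ i                ≡⟨ ≡.cong (_∸ i) (ℕ.+-comm m ℓ) ⟩
      ℓ ℕ.+ m ∸ i                ≡⟨ ℕ.+-∸-assoc ℓ i≤m ⟩
      ℓ ℕ.+ (m ∸ i)              ∎

module MultipleAlmostRiordan {c r} (K : CommutativeRing c r) where
  open CommutativeRing K
  open PS K
  open FiniteSums K
  open SeriesRing K
  open Monomials K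
  open Order K
  open Composition K
  module ≈-Reasoning = Relation.Binary.Reasoning.Setoid setoid
  module ≋-Reasoning = Relation.Binary.Reasoning.Setoid S.setoid

  module Columns (ℓ : ℕ) .{{_ : NonZero ℓ}} (b g : Series) (f : ℕ → Series)
                 (g∈K[[tˡ]] : InPowSeries ℓ g) (f∈tK[[tˡ]] : AllUpTo ℓ (λ i → InTPowSeries ℓ (f i)))
                 (h : Series) (h₀≈0 : h 0 ≈ 0#) (hˡ≋∏f : pow h ℓ ≋ prodS ℓ f) where
    open Exponents K ℓ
    open Spread K ℓ
    open import Data.Nat.Divisibility using (>⇒∤)

    private
      d : ℕ → ℕ → Carrier
      d = entry ℓ b g f

    baseColumn : ℕ → Series
    baseColumn m = tS ⊛ g ⊛ prodS m f

    leadingCoeff : ℕ → Carrier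
    leadingCoeff m = g 0 * prodC m (λ i → f i 1)

    column-base : ∀ m → m < ℓ → column ℓ b g f (suc m) ≋ baseColumn m
    column-base m m<ℓ =
      ⊛-congˡ (tS ⊛ g) (S.trans (prodS-oneS-tail _ (ℕ.≤⇒≤′ (ℕ.<⇒≤ m<ℓ)) exponent-0) (prodS-cong m exponent-1))
      where
      exponent-0 : ∀ i → m < i → i ≤ ℓ → pow (f i) (expo ℓ i (suc m)) ≋ oneS
      exponent-0 i m<i i≤ℓ = S.reflexive (≡.cong (pow (f i)) (expo-≡0 i m m<i i≤ℓ))
      exponent-1 : AllUpTo m (λ i → pow (f i) (expo ℓ i (suc m)) ≋ f i)
      exponent-1 i _ i≤m = S.trans (S.reflexive (≡.cong (pow (f i)) (expo-≡1 i m i≤m m<ℓ))) (⊛-identityʳ (f i))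

    column-periodic : ∀ m j → column ℓ b g f (suc m ℕ.+ ℓ ℕ.* j) ≋ column ℓ b g f (suc m) ⊛ pow h (ℓ ℕ.* j)
    column-periodic m j = S.trans (⊛-congˡ (tS ⊛ g) factors) (S.sym (⊛-assoc (tS ⊛ g) (prodS ℓ E) (pow h (ℓ ℕ.* j))))
      where
      E : ℕ → Series
      E i = pow (f i) (expo ℓ i (suc m))
      factors : prodS ℓ (λ i → pow (f i) (expo ℓ i (suc m ℕ.+ ℓ ℕ.* j))) ≋ prodS ℓ E ⊛ pow h (ℓ ℕ.* j)
      factors = begin
        prodS ℓ (λ i → pow (f i) (expo ℓ i (suc m ℕ.+ ℓ ℕ.* j)))
          ≈⟨ prodS-cong ℓ (λ i _ _ → S.trans (S.reflexive (≡.cong (pow (f i)) (expo-periodic i m j)))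
                                             (pow-+ (expo ℓ i (suc m)) j (f i))) ⟩
        prodS ℓ (λ i → E i ⊛ pow (f i) j)
          ≈⟨ prodS-⊛ ℓ E (λ i → pow (f i) j) ⟩
        prodS ℓ E ⊛ prodS ℓ (λ i → pow (f i) j)
          ≈⟨ ⊛-congˡ (prodS ℓ E) (prodS-pow ℓ f j) ⟩
        prodS ℓ E ⊛ pow (prodS ℓ f) j
          ≈⟨ ⊛-congˡ (prodS ℓ E) (S.trans (pow-cong j (S.sym hˡ≋∏f)) (S.sym (pow-* ℓ j h))) ⟩
        prodS ℓ E ⊛ pow h (ℓ ℕ.* j) ∎
        where open ≋-Reasoning

    entry-periodic : ∀ m j n → m < ℓ → d n (suc m ℕ.+ ℓ ℕ.* j) ≈ (baseColumn m ⊛ pow h (ℓ ℕ.* j)) n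
    entry-periodic m j n m<ℓ = S.trans (column-periodic m j) (⊛-congʳ (pow h (ℓ ℕ.* j)) (column-base m m<ℓ)) n

    rowSum-base : ∀ s m n → m < ℓ →
      sumTo (suc n) (λ j → s j * d n (suc m ℕ.+ ℓ ℕ.* j)) ≈ (baseColumn m ⊛ comp (spread ℓ s) h) n
    rowSum-base s m n m<ℓ = trans (sumTo-cong (suc n) (λ j → *-congˡ (entry-periodic m j n m<ℓ)))
                                  (sym (⊛-comp-spread (vanishesBelow-1 h₀≈0) s (baseColumn m) n))

    f₀≈0 : AllUpTo ℓ (λ i → VanishesBelow 1 (f i))
    f₀≈0 i 1≤i i≤ℓ = vanishesBelow-1 (proj₁ (f∈tK[[tˡ]] i 1≤i i≤ℓ))

    tS₀≈0 : VanishesBelow 1 tS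
    tS₀≈0 = vanishesBelow-1 (tpow-off 1 0 λ ())

    vanishesBelow-baseColumn : ∀ m → m ≤ ℓ → VanishesBelow (suc m) (baseColumn m)
    vanishesBelow-baseColumn m m≤ℓ =
      vanishesBelow-⊛ 1 m (vanishesBelow-⊛ 1 0 tS₀≈0 (vanishesBelow-0 g)) (vanishesBelow-prodS m f (allUpTo-≤ m≤ℓ f₀≈0))

    baseColumn-leading : ∀ m → m ≤ ℓ → baseColumn m (suc m) ≈ leadingCoeff m
    baseColumn-leading m m≤ℓ = begin
      baseColumn m (1 ℕ.+ m)
        ≈⟨ ⊛-leading 1 m (vanishesBelow-⊛ 1 0 tS₀≈0 (vanishesBelow-0 g)) (vanishesBelow-prodS m f f₀≈0′) ⟩
      (tS ⊛ g) (1 ℕ.+ 0) * prodS m f m ≈⟨ *-cong (⊛-leading 1 0 tS₀≈0 (vanishesBelow-0 g)) (prodS-leading m f f₀≈0′) ⟩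
      tS 1 * g 0 * prodC m (λ i → f i 1) ≈⟨ *-congʳ (trans (*-congʳ (tpow-diag 1)) (*-identityˡ _)) ⟩
      leadingCoeff m                   ∎
      where
      open ≈-Reasoning
      f₀≈0′ : AllUpTo m (λ i → VanishesBelow 1 (f i))
      f₀≈0′ = allUpTo-≤ m≤ℓ f₀≈0

    monomialBelow-baseColumn : ∀ m → m ≤ ℓ → MonomialBelow ℓ (suc m) (baseColumn m)
    monomialBelow-baseColumn m m≤ℓ = monomialBelow-⊛ ℓ 1 m (monomialBelow-⊛ ℓ 1 0 tS-monomial g-constant)
                                                          (monomialBelow-prodS ℓ m f (allUpTo-≤ m≤ℓ f-linear))
      where
      tS-monomial : MonomialBelow ℓ 1 tS
      tS-monomial n _ n≢1 = tpow-off 1 n (n≢1 ∘ ≡.sym)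
      g-constant : MonomialBelow ℓ 0 g
      g-constant zero    _   0≢0 = contradiction ≡.refl 0≢0
      g-constant (suc n) n<ℓ _   = g∈K[[tˡ]] (suc n) (>⇒∤ n<ℓ)
      f-linear : AllUpTo ℓ (λ i → MonomialBelow ℓ 1 (f i))
      f-linear i 1≤i i≤ℓ zero          _   _   = proj₁ (f∈tK[[tˡ]] i 1≤i i≤ℓ)
      f-linear i 1≤i i≤ℓ (suc zero)    _   1≢1 = contradiction ≡.refl 1≢1
      f-linear i 1≤i i≤ℓ (suc (suc n)) n<ℓ _   =
        proj₂ (f∈tK[[tˡ]] i 1≤i i≤ℓ) (suc n) (>⇒∤ (ℕ.<-trans (ℕ.n<1+n (suc n)) n<ℓ))

    ℓ′ : ℕ
    ℓ′ = ℓ ∸ 1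

    1+ℓ′≡ℓ : suc ℓ′ ≡ ℓ
    1+ℓ′≡ℓ = ℕ.suc-pred ℓ

    ℓ′<ℓ : ℓ′ < ℓ
    ℓ′<ℓ = ≡.subst (ℓ′ <_) 1+ℓ′≡ℓ ℕ.≤-refl

    column-ℓ : column ℓ b g f ℓ ≋ baseColumn ℓ′
    column-ℓ = ≡.subst (λ k → column ℓ b g f k ≋ baseColumn ℓ′) 1+ℓ′≡ℓ (column-base ℓ′ ℓ′<ℓ)

    columnsAtMultiples : (ℕ → Carrier) → Series
    columnsAtMultiples s = s 0 ·ₛ b ⊕ baseColumn ℓ′ ⊛ comp (spread ℓ (λ j → s (suc j))) h

    rowSum-multiples : ∀ s n → sumTo (suc n) (λ j → s j * d n (ℓ ℕ.* j)) ≈ columnsAtMultiples s n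
    rowSum-multiples s n = begin
      sumTo (suc n) (λ j → s j * d n (ℓ ℕ.* j))
        ≈⟨ sumTo-head n _ ⟩
      s 0 * d n (ℓ ℕ.* 0) + sumTo n (λ j → s (suc j) * d n (ℓ ℕ.* suc j))
        ≈⟨ +-cong (reflexive (≡.cong (λ k → s 0 * d n k) (ℕ.*-zeroʳ ℓ)))
                  (sumTo-cong n (λ j → reflexive (≡.cong (λ k → s (suc j) * d n k) (index j)))) ⟩
      s 0 * b n + sumTo n (λ j → s (suc j) * d n (suc ℓ′ ℕ.+ ℓ ℕ.* j))
        ≈⟨ +-congˡ (sumTo-extend n (suc n) _ (ℕ.n≤1+n n) beyond-row) ⟩
      s 0 * b n + sumTo (suc n) (λ j → s (suc j) * d n (suc ℓ′ ℕ.+ ℓ ℕ.* j))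
        ≈⟨ +-congˡ (rowSum-base (λ j → s (suc j)) ℓ′ n ℓ′<ℓ) ⟩
      columnsAtMultiples s n ∎
      where
      open ≈-Reasoning
      index : ∀ j → ℓ ℕ.* suc j ≡ suc ℓ′ ℕ.+ ℓ ℕ.* j
      index j = ≡.trans (ℕ.*-suc ℓ j) (≡.cong (ℕ._+ ℓ ℕ.* j) (≡.sym 1+ℓ′≡ℓ))
      beyond-row : ∀ j → n ≤ j → j < suc n → s (suc j) * d n (suc ℓ′ ℕ.+ ℓ ℕ.* j) ≈ 0#
      beyond-row j n≤j _ = trans (*-congˡ (trans (entry-periodic ℓ′ j n ℓ′<ℓ) (vanishes n n<index))) (zeroʳ _)
        where
        vanishes : VanishesBelow (suc ℓ′ ℕ.+ ℓ ℕ.* j) (baseColumn ℓ′ ⊛ pow h (ℓ ℕ.* j))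
        vanishes = vanishesBelow-⊛ (suc ℓ′) (ℓ ℕ.* j) (vanishesBelow-baseColumn ℓ′ (ℕ.<⇒≤ ℓ′<ℓ))
                                   (vanishesBelow-pow (ℓ ℕ.* j) (vanishesBelow-1 h₀≈0))
        n<index : n < suc ℓ′ ℕ.+ ℓ ℕ.* j
        n<index = s≤s (ℕ.≤-trans (ℕ.≤-trans n≤j (ℕ.m≤n*m j ℓ)) (ℕ.m≤n+m (ℓ ℕ.* j) ℓ′))

    A-columns : ∀ {a} → IsASequence ℓ b g f a →
      baseColumn 0 ⊛ pow h ℓ ≋ tpow ℓ ⊛ (baseColumn 0 ⊛ comp (spread ℓ a) h)
    A-columns {a} isA = ≋-tpow-⊛ ℓ low shifted
      where
      0<ℓ : 0 < ℓ
      0<ℓ = ℕ.>-nonZero⁻¹ ℓ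
      column-1+ℓ : column ℓ b g f (suc ℓ) ≋ baseColumn 0 ⊛ pow h ℓ
      column-1+ℓ = ≡.subst (λ k → column ℓ b g f (suc k) ≋ baseColumn 0 ⊛ pow h k) (ℕ.*-identityʳ ℓ)
                     (S.trans (column-periodic 0 1) (⊛-congʳ (pow h (ℓ ℕ.* 1)) (column-base 0 0<ℓ)))
      low : ∀ n → n < ℓ → (baseColumn 0 ⊛ pow h ℓ) n ≈ 0#
      low n n<ℓ = vanishesBelow-⊛ 1 ℓ (vanishesBelow-baseColumn 0 z≤n) (vanishesBelow-pow ℓ (vanishesBelow-1 h₀≈0))
                                  n (ℕ.m<n⇒m<1+n n<ℓ)
      shifted : ∀ n → (baseColumn 0 ⊛ pow h ℓ) (n ℕ.+ ℓ) ≈ (baseColumn 0 ⊛ comp (spread ℓ a) h) n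
      shifted n = begin
        (baseColumn 0 ⊛ pow h ℓ) (n ℕ.+ ℓ)                      ≈⟨ column-1+ℓ (n ℕ.+ ℓ) ⟨
        d (n ℕ.+ ℓ) (suc ℓ)                                      ≈⟨ isA n (suc ℓ) ℕ.≤-refl ⟩
        sumTo (suc n) (λ j → a j * d n (suc ℓ ∸ ℓ ℕ.+ ℓ ℕ.* j))
          ≡⟨ ≡.cong (λ k → sumTo (suc n) (λ j → a j * d n (k ℕ.+ ℓ ℕ.* j))) (ℕ.m+n∸n≡m 1 ℓ) ⟩
        sumTo (suc n) (λ j → a j * d n (1 ℕ.+ ℓ ℕ.* j))          ≈⟨ rowSum-base a 0 n 0<ℓ ⟩
        (baseColumn 0 ⊛ comp (spread ℓ a) h) n                  ∎
        where open ≈-Reasoning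

    Z-columns : ∀ m {z} → suc m < ℓ → IsZSequence ℓ b g f (suc m) z →
      baseColumn m ≋ leadingCoeff m ·ₛ tpow (suc m) ⊕ tpow ℓ ⊛ (baseColumn m ⊛ comp (spread ℓ z) h)
    Z-columns m {z} 1+m<ℓ isZ = ≋-⊕-tpow-⊛ ℓ low high shifted
      where
      m<ℓ : m < ℓ
      m<ℓ = ℕ.<-trans (ℕ.n<1+n m) 1+m<ℓ
      low : ∀ n → n < ℓ → baseColumn m n ≈ leadingCoeff m * tpow (suc m) n
      low n n<ℓ with n ℕ.≟ suc m
      ... | yes ≡.refl = trans (baseColumn-leading m (ℕ.<⇒≤ m<ℓ)) (sym (trans (*-congˡ (tpow-diag n)) (*-identityʳ _)))
      ... | no  n≢1+m  = trans (monomialBelow-baseColumn m (ℕ.<⇒≤ m<ℓ) n n<ℓ n≢1+m)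
                               (sym (trans (*-congˡ (tpow-off (suc m) n (n≢1+m ∘ ≡.sym))) (zeroʳ _)))
      high : ∀ n → ℓ ≤ n → leadingCoeff m * tpow (suc m) n ≈ 0#
      high n ℓ≤n = trans (*-congˡ (tpow-off (suc m) n λ { ≡.refl → ℕ.<⇒≱ 1+m<ℓ ℓ≤n })) (zeroʳ _)
      shifted : ∀ n → baseColumn m (n ℕ.+ ℓ) ≈ (baseColumn m ⊛ comp (spread ℓ z) h) n
      shifted n = trans (sym (column-base m m<ℓ (n ℕ.+ ℓ))) (trans (isZ n) (rowSum-base z m n m<ℓ))

    Zℓ-columns : ∀ {z} → IsZℓSequence ℓ b g f z → baseColumn ℓ′ ≋ tpow ℓ ⊛ columnsAtMultiples z
    Zℓ-columns {z} isZ = ≋-tpow-⊛ ℓ low shifted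
      where
      low : ∀ n → n < ℓ → baseColumn ℓ′ n ≈ 0#
      low n n<ℓ = vanishesBelow-baseColumn ℓ′ (ℕ.<⇒≤ ℓ′<ℓ) n (≡.subst (n <_) (≡.sym 1+ℓ′≡ℓ) n<ℓ)
      shifted : ∀ n → baseColumn ℓ′ (n ℕ.+ ℓ) ≈ columnsAtMultiples z n
      shifted n = trans (sym (column-ℓ (n ℕ.+ ℓ))) (trans (isZ n) (rowSum-multiples z n))

    Zℓ-head : ∀ {z} → IsZℓSequence ℓ b g f z → z 0 * b 0 ≈ leadingCoeff ℓ′
    Zℓ-head {z} isZ = begin
      z 0 * b 0                              ≡⟨ ≡.cong (λ k → z 0 * d 0 k) (ℕ.*-zeroʳ ℓ) ⟨
      z 0 * d 0 (ℓ ℕ.* 0)                    ≈⟨ +-identityˡ _ ⟨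
      sumTo 1 (λ j → z j * d 0 (ℓ ℕ.* j))    ≈⟨ isZ 0 ⟨
      d ℓ ℓ                                  ≈⟨ column-ℓ ℓ ⟩
      baseColumn ℓ′ ℓ                        ≡⟨ ≡.cong (baseColumn ℓ′) 1+ℓ′≡ℓ ⟨
      baseColumn ℓ′ (suc ℓ′)                 ≈⟨ baseColumn-leading ℓ′ (ℕ.<⇒≤ ℓ′<ℓ) ⟩
      leadingCoeff ℓ′                        ∎
      where open ≈-Reasoning

    W-columns : ∀ {w} → InPowSeries ℓ b → IsWSequence ℓ b g f w → b ≋ const (b 0) ⊕ tpow ℓ ⊛ columnsAtMultiples w
    W-columns {w} b∈K[[tˡ]] isW = ≋-⊕-tpow-⊛ ℓ low (const-vanishes ℓ (b 0)) (λ n → trans (isW n) (rowSum-multiples w n))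
      where
      low : ∀ n → n < ℓ → b n ≈ const (b 0) n
      low zero    _   = refl
      low (suc n) n<ℓ = b∈K[[tˡ]] (suc n) (>⇒∤ n<ℓ)

    W-head : ∀ {w} → IsWSequence ℓ b g f w → w 0 * b 0 ≈ b ℓ
    W-head {w} isW = begin
      w 0 * b 0                              ≡⟨ ≡.cong (λ k → w 0 * d 0 k) (ℕ.*-zeroʳ ℓ) ⟨
      w 0 * d 0 (ℓ ℕ.* 0)                    ≈⟨ +-identityˡ _ ⟨
      sumTo 1 (λ j → w j * d 0 (ℓ ℕ.* j))    ≈⟨ isW 0 ⟨
      b ℓ                                    ∎
      where open ≈-Reasoning

  module Substitution (ℓ : ℕ) .{{_ : NonZero ℓ}} (b g : Series) (f : ℕ → Series)
                      (g∈K[[tˡ]] : InPowSeries ℓ g) (f∈tK[[tˡ]] : AllUpTo ℓ (λ i → InTPowSeries ℓ (f i)))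
                      (h : Series) (h₀≈0 : h 0 ≈ 0#) (hˡ≋∏f : pow h ℓ ≋ prodS ℓ f)
                      (h̄ : Series) (h̄₀≈0 : h̄ 0 ≈ 0#) (h∘h̄≋t : comp h h̄ ≋ tS)
                      {g₀⁻¹ : Carrier} (g₀g₀⁻¹≈1 : g 0 * g₀⁻¹ ≈ 1#) where
    open Columns ℓ b g f g∈K[[tˡ]] f∈tK[[tˡ]] h h₀≈0 hˡ≋∏f public
    open Spread K ℓ
    open Cancellation K
    open ≋-Reasoning
    open ⊛-Solver using (solve; _:+_; _:*_; _:=_)
    open import Algebra.Properties.Ring S.ring using (x≈z//y; [y-z]x≈yx-zx)

    φ : Series → Series
    φ X = comp X h̄

    H̄ℓ G B Fℓ : Series
    H̄ℓ = pow h̄ ℓ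
    G  = comp g h̄
    B  = comp b h̄
    Fℓ = comp (f ℓ) h̄

    F : ℕ → Series
    F m = prodS m (λ i → comp (f i) h̄)

    h̄₀≈0′ : VanishesBelow 1 h̄
    h̄₀≈0′ = vanishesBelow-1 h̄₀≈0

    φ-cong : ∀ {X Y} → X ≋ Y → φ X ≋ φ Y
    φ-cong = comp-congˡ h̄

    φ-tpow-⊛ : ∀ X → φ (tpow ℓ ⊛ X) ≋ H̄ℓ ⊛ φ X
    φ-tpow-⊛ X = S.trans (comp-⊛ h̄₀≈0′ (tpow ℓ) X) (⊛-congʳ (φ X) (comp-tpow h̄₀≈0′ ℓ))

    φ-baseColumn : ∀ m → φ (baseColumn m) ≋ h̄ ⊛ G ⊛ F m
    φ-baseColumn m = begin
      φ (tS ⊛ g ⊛ prodS m f)          ≈⟨ comp-⊛ h̄₀≈0′ (tS ⊛ g) (prodS m f) ⟩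
      φ (tS ⊛ g) ⊛ φ (prodS m f)      ≈⟨ S.*-cong (comp-⊛ h̄₀≈0′ tS g) (comp-prodS h̄₀≈0′ m f) ⟩
      φ tS ⊛ G ⊛ F m                  ≈⟨ ⊛-congʳ (F m) (⊛-congʳ G (S.trans (comp-tpow h̄₀≈0′ 1) (⊛-identityʳ h̄))) ⟩
      h̄ ⊛ G ⊛ F m                     ∎

    φ-∘h : ∀ A → φ (comp A h) ≋ A
    φ-∘h A = S.trans (comp-assoc h̄₀≈0′ (vanishesBelow-1 h₀≈0) A) (S.trans (comp-cong S.refl h∘h̄≋t) (comp-tS A))

    φ-baseColumn-⊛-∘h : ∀ m A → φ (baseColumn m ⊛ comp A h) ≋ h̄ ⊛ G ⊛ F m ⊛ A
    φ-baseColumn-⊛-∘h m A = S.trans (comp-⊛ h̄₀≈0′ (baseColumn m) (comp A h)) (S.*-cong (φ-baseColumn m) (φ-∘h A))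

    φ-hˡ : φ (pow h ℓ) ≋ tpow ℓ
    φ-hˡ = begin
      φ (pow h ℓ)          ≈⟨ comp-pow h̄₀≈0′ h ℓ ⟩
      pow (comp h h̄) ℓ     ≈⟨ pow-cong ℓ h∘h̄≋t ⟩
      pow tS ℓ             ≈⟨ pow-tS ℓ ⟩
      tpow ℓ               ∎

    F-ℓ′-⊛-Fℓ : F ℓ′ ⊛ Fℓ ≋ tpow ℓ
    F-ℓ′-⊛-Fℓ = begin
      F ℓ′ ⊛ Fℓ          ≡⟨ ≡.cong (λ k → F ℓ′ ⊛ comp (f k) h̄) 1+ℓ′≡ℓ ⟨
      F (suc ℓ′)         ≡⟨ ≡.cong F 1+ℓ′≡ℓ ⟩
      F ℓ                ≈⟨ comp-prodS h̄₀≈0′ ℓ f ⟨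
      φ (prodS ℓ f)      ≈⟨ φ-cong hˡ≋∏f ⟨
      φ (pow h ℓ)        ≈⟨ φ-hˡ ⟩
      tpow ℓ             ∎

    cancel-h̄ : ∀ {X Y} → h̄ ⊛ X ≋ h̄ ⊛ Y → X ≋ Y
    cancel-h̄ = ⊛-cancelˡ-order1 h̄ h̄₀≈0 h̄₁h₁≈1
      where
      h̄₁h₁≈1 : h̄ 1 * h 1 ≈ 1#
      h̄₁h₁≈1 = trans (*-comm _ _) (trans (sym (comp-coeff-1 h h̄)) (trans (h∘h̄≋t 1) (tpow-diag 1)))

    cancel-G : ∀ {X Y} → G ⊛ X ≋ G ⊛ Y → X ≋ Y
    cancel-G = ⊛-cancelˡ-unit G (trans (*-congʳ (comp-coeff-0 g h̄)) g₀g₀⁻¹≈1)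

    spread-head′ : ∀ s → spread ℓ s ≋ const (s 0) ⊕ F ℓ′ ⊛ Fℓ ⊛ spread ℓ (λ j → s (suc j))
    spread-head′ s = S.trans (spread-head s) (⊕-congˡ (const (s 0)) (⊛-congʳ (spread ℓ (λ j → s (suc j))) (S.sym F-ℓ′-⊛-Fℓ)))

    φ-tpow-⊛-columnsAtMultiples : ∀ s →
      φ (tpow ℓ ⊛ columnsAtMultiples s) ≋ H̄ℓ ⊛ (const (s 0) ⊛ B ⊕ h̄ ⊛ G ⊛ F ℓ′ ⊛ spread ℓ (λ j → s (suc j)))
    φ-tpow-⊛-columnsAtMultiples s = S.trans (φ-tpow-⊛ (columnsAtMultiples s)) (⊛-congˡ H̄ℓ (S.trans (comp-⊕ _ _ h̄)
      (S.+-cong (S.trans (comp-·ₛ (s 0) b h̄) (·ₛ-≋-const-⊛ (s 0) B)) (φ-baseColumn-⊛-∘h ℓ′ _))))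

    A-generatingFunction : ∀ {a} → IsASequence ℓ b g f a → H̄ℓ ⊛ spread ℓ a ≋ tpow ℓ
    A-generatingFunction {a} isA = S.sym (cancel-G (cancel-h̄ (begin
      h̄ ⊛ (G ⊛ tpow ℓ)                          ≈⟨ S.*-assoc h̄ G (tpow ℓ) ⟨
      h̄ ⊛ G ⊛ tpow ℓ                            ≈⟨ ⊛-congʳ (tpow ℓ) (S.*-identityʳ (h̄ ⊛ G)) ⟨
      h̄ ⊛ G ⊛ F 0 ⊛ tpow ℓ                      ≈⟨ S.*-cong (φ-baseColumn 0) φ-hˡ ⟨
      φ (baseColumn 0) ⊛ φ (pow h ℓ)            ≈⟨ comp-⊛ h̄₀≈0′ (baseColumn 0) (pow h ℓ) ⟨
      φ (baseColumn 0 ⊛ pow h ℓ)                ≈⟨ φ-cong (A-columns isA) ⟩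
      φ (tpow ℓ ⊛ (baseColumn 0 ⊛ comp A h))    ≈⟨ φ-tpow-⊛ _ ⟩
      H̄ℓ ⊛ φ (baseColumn 0 ⊛ comp A h)          ≈⟨ ⊛-congˡ H̄ℓ (φ-baseColumn-⊛-∘h 0 A) ⟩
      H̄ℓ ⊛ (h̄ ⊛ G ⊛ F 0 ⊛ A)                    ≈⟨ ⊛-congˡ H̄ℓ (⊛-congʳ A (S.*-identityʳ (h̄ ⊛ G))) ⟩
      H̄ℓ ⊛ (h̄ ⊛ G ⊛ A)                          ≈⟨ solve 4 (λ l x g a → l :* (x :* g :* a) := x :* (g :* (l :* a)))
                                                           S.refl H̄ℓ h̄ G A ⟩
      h̄ ⊛ (G ⊛ (H̄ℓ ⊛ A))                        ∎)))
      where
      A : Series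
      A = spread ℓ a

    Z-generatingFunction : ∀ m {z} → suc m < ℓ → IsZSequence ℓ b g f (suc m) z →
      H̄ℓ ⊛ (G ⊛ F m) ⊛ spread ℓ z ≋ G ⊛ F m ⊖ leadingCoeff m ·ₛ pow h̄ m
    Z-generatingFunction m {z} 1+m<ℓ isZ = x≈z//y _ _ _ (S.trans (S.+-comm _ _) (S.sym P≋))
      where
      Z P cₘ : Series
      Z = spread ℓ z
      P = G ⊛ F m
      cₘ = const (leadingCoeff m)
      P≋ : P ≋ leadingCoeff m ·ₛ pow h̄ m ⊕ H̄ℓ ⊛ P ⊛ Z
      P≋ = cancel-h̄ (begin
        h̄ ⊛ P                                        ≈⟨ S.*-assoc h̄ G (F m) ⟨
        h̄ ⊛ G ⊛ F m                                  ≈⟨ φ-baseColumn m ⟨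
        φ (baseColumn m)                             ≈⟨ φ-cong (Z-columns m 1+m<ℓ isZ) ⟩
        φ (leadingCoeff m ·ₛ tpow (suc m) ⊕ tpow ℓ ⊛ (baseColumn m ⊛ comp Z h))
          ≈⟨ comp-⊕ _ _ h̄ ⟩
        φ (leadingCoeff m ·ₛ tpow (suc m)) ⊕ φ (tpow ℓ ⊛ (baseColumn m ⊛ comp Z h))
          ≈⟨ S.+-cong (S.trans (comp-·ₛ _ _ h̄) (S.trans (·ₛ-cong _ (comp-tpow h̄₀≈0′ (suc m))) (·ₛ-≋-const-⊛ _ _)))
                      (S.trans (φ-tpow-⊛ _) (⊛-congˡ H̄ℓ (φ-baseColumn-⊛-∘h m Z))) ⟩
        cₘ ⊛ (h̄ ⊛ pow h̄ m) ⊕ H̄ℓ ⊛ (h̄ ⊛ G ⊛ F m ⊛ Z)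
          ≈⟨ solve 7 (λ c x hᵐ l g fm s → c :* (x :* hᵐ) :+ l :* (x :* g :* fm :* s) := x :* (c :* hᵐ :+ l :* (g :* fm) :* s))
                   S.refl cₘ h̄ (pow h̄ m) H̄ℓ G (F m) Z ⟩
        h̄ ⊛ (cₘ ⊛ pow h̄ m ⊕ H̄ℓ ⊛ P ⊛ Z)
          ≈⟨ ⊛-congˡ h̄ (⊕-congʳ (H̄ℓ ⊛ P ⊛ Z) (·ₛ-≋-const-⊛ (leadingCoeff m) (pow h̄ m))) ⟨
        h̄ ⊛ (leadingCoeff m ·ₛ pow h̄ m ⊕ H̄ℓ ⊛ P ⊛ Z)  ∎)

    Z₁-generatingFunction : ∀ {z} → 1 < ℓ → IsZSequence ℓ b g f 1 z → H̄ℓ ⊛ G ⊛ spread ℓ z ≋ G ⊖ const (g 0)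
    Z₁-generatingFunction {z} 1<ℓ isZ = begin
      H̄ℓ ⊛ G ⊛ spread ℓ z                       ≈⟨ ⊛-congʳ (spread ℓ z) (⊛-congˡ H̄ℓ (S.*-identityʳ G)) ⟨
      H̄ℓ ⊛ (G ⊛ F 0) ⊛ spread ℓ z               ≈⟨ Z-generatingFunction 0 1<ℓ isZ ⟩
      G ⊛ F 0 ⊖ leadingCoeff 0 ·ₛ oneS          ≈⟨ (λ n → +-cong (S.*-identityʳ G n) (-‿cong (g₀·oneS n))) ⟩
      G ⊖ const (g 0)                           ∎
      where
      g₀·oneS : leadingCoeff 0 ·ₛ oneS ≋ const (g 0)
      g₀·oneS zero    = trans (*-identityʳ _) (*-identityʳ _)
      g₀·oneS (suc n) = zeroʳ _

    Zℓ-generatingFunction : ∀ {z} → IsZℓSequence ℓ b g f z →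
      b 0 ·ₛ (H̄ℓ ⊛ h̄ ⊛ G ⊛ spread ℓ z)
        ≋ leadingCoeff ℓ′ ·ₛ (H̄ℓ ⊛ h̄ ⊛ G) ⊕ b 0 ·ₛ (tpow ℓ ⊛ h̄ ⊛ G) ⊖ leadingCoeff ℓ′ ·ₛ (H̄ℓ ⊛ B ⊛ Fℓ)
    Zℓ-generatingFunction {z} isZ = x≈z//y _ _ _ (begin
      b 0 ·ₛ (H̄ℓ ⊛ h̄ ⊛ G ⊛ spread ℓ z) ⊕ C ·ₛ (H̄ℓ ⊛ B ⊛ Fℓ)
        ≈⟨ S.+-cong (S.trans (·ₛ-≋-const-⊛ _ _) (⊛-congˡ cb₀ (⊛-congˡ (H̄ℓ ⊛ h̄ ⊛ G) (spread-head′ z))))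
                    (S.trans (·ₛ-≋-const-⊛ _ _) (⊛-congʳ (H̄ℓ ⊛ B ⊛ Fℓ) (S.sym cz₀⊛cb₀≋C))) ⟩
      cb₀ ⊛ (H̄ℓ ⊛ h̄ ⊛ G ⊛ (cz₀ ⊕ F ℓ′ ⊛ Fℓ ⊛ S′)) ⊕ cz₀ ⊛ cb₀ ⊛ (H̄ℓ ⊛ B ⊛ Fℓ)
        ≈⟨ solve 9 (λ b₀ l x g z₀ f′ fℓ s bh →
                      b₀ :* (l :* x :* g :* (z₀ :+ f′ :* fℓ :* s)) :+ z₀ :* b₀ :* (l :* bh :* fℓ)
                   := z₀ :* b₀ :* (l :* x :* g) :+ b₀ :* fℓ :* (l :* (z₀ :* bh :+ x :* g :* f′ :* s)))
                   S.refl cb₀ H̄ℓ h̄ G cz₀ (F ℓ′) Fℓ S′ B ⟩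
      cz₀ ⊛ cb₀ ⊛ (H̄ℓ ⊛ h̄ ⊛ G) ⊕ cb₀ ⊛ Fℓ ⊛ (H̄ℓ ⊛ (cz₀ ⊛ B ⊕ Q ⊛ S′))
        ≈⟨ ⊕-congˡ (cz₀ ⊛ cb₀ ⊛ (H̄ℓ ⊛ h̄ ⊛ G)) (⊛-congˡ (cb₀ ⊛ Fℓ) Q≋) ⟨
      cz₀ ⊛ cb₀ ⊛ (H̄ℓ ⊛ h̄ ⊛ G) ⊕ cb₀ ⊛ Fℓ ⊛ Q
        ≈⟨ ⊕-congˡ (cz₀ ⊛ cb₀ ⊛ (H̄ℓ ⊛ h̄ ⊛ G))
                   (solve 5 (λ b₀ fℓ x g f′ → b₀ :* fℓ :* (x :* g :* f′) := b₀ :* (f′ :* fℓ :* x :* g))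
                            S.refl cb₀ Fℓ h̄ G (F ℓ′)) ⟩
      cz₀ ⊛ cb₀ ⊛ (H̄ℓ ⊛ h̄ ⊛ G) ⊕ cb₀ ⊛ (F ℓ′ ⊛ Fℓ ⊛ h̄ ⊛ G)
        ≈⟨ S.+-cong (S.trans (⊛-congʳ (H̄ℓ ⊛ h̄ ⊛ G) cz₀⊛cb₀≋C) (S.sym (·ₛ-≋-const-⊛ _ _)))
                    (S.trans (⊛-congˡ cb₀ (⊛-congʳ G (⊛-congʳ h̄ F-ℓ′-⊛-Fℓ))) (S.sym (·ₛ-≋-const-⊛ _ _))) ⟩
      C ·ₛ (H̄ℓ ⊛ h̄ ⊛ G) ⊕ b 0 ·ₛ (tpow ℓ ⊛ h̄ ⊛ G) ∎)
      where
      C : Carrier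
      C = leadingCoeff ℓ′
      cb₀ cz₀ S′ Q : Series
      cb₀ = const (b 0)
      cz₀ = const (z 0)
      S′ = spread ℓ (λ j → z (suc j))
      Q = h̄ ⊛ G ⊛ F ℓ′
      Q≋ : Q ≋ H̄ℓ ⊛ (cz₀ ⊛ B ⊕ Q ⊛ S′)
      Q≋ = S.trans (S.sym (φ-baseColumn ℓ′)) (S.trans (φ-cong (Zℓ-columns isZ)) (φ-tpow-⊛-columnsAtMultiples z))
      cz₀⊛cb₀≋C : cz₀ ⊛ cb₀ ≋ const C
      cz₀⊛cb₀≋C = S.trans (const-⊛-const (z 0) (b 0)) (const-cong (Zℓ-head isZ))

    W-generatingFunction : ∀ {w} → InPowSeries ℓ b → IsWSequence ℓ b g f w →
      H̄ℓ ⊛ h̄ ⊛ G ⊛ spread ℓ w ≋ Fℓ ⊛ ((oneS ⊖ w 0 ·ₛ H̄ℓ) ⊛ B ⊖ const (b 0)) ⊕ w 0 ·ₛ (H̄ℓ ⊛ h̄ ⊛ G)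
    W-generatingFunction {w} b∈K[[tˡ]] isW = begin
      H̄ℓ ⊛ h̄ ⊛ G ⊛ spread ℓ w
        ≈⟨ ⊛-congˡ (H̄ℓ ⊛ h̄ ⊛ G) (spread-head′ w) ⟩
      H̄ℓ ⊛ h̄ ⊛ G ⊛ (cw₀ ⊕ F ℓ′ ⊛ Fℓ ⊛ S′)
        ≈⟨ solve 7 (λ l x g w₀ f′ fℓ s →
                      l :* x :* g :* (w₀ :+ f′ :* fℓ :* s) := fℓ :* (l :* (x :* g :* f′ :* s)) :+ w₀ :* (l :* x :* g))
                   S.refl H̄ℓ h̄ G cw₀ (F ℓ′) Fℓ S′ ⟩
      Fℓ ⊛ (H̄ℓ ⊛ (Q ⊛ S′)) ⊕ cw₀ ⊛ (H̄ℓ ⊛ h̄ ⊛ G)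
        ≈⟨ S.+-cong (⊛-congˡ Fℓ remainder) (S.sym (·ₛ-≋-const-⊛ _ _)) ⟩
      Fℓ ⊛ ((oneS ⊖ w 0 ·ₛ H̄ℓ) ⊛ B ⊖ cb₀) ⊕ w 0 ·ₛ (H̄ℓ ⊛ h̄ ⊛ G) ∎
      where
      cb₀ cw₀ S′ Q : Series
      cb₀ = const (b 0)
      cw₀ = const (w 0)
      S′ = spread ℓ (λ j → w (suc j))
      Q = h̄ ⊛ G ⊛ F ℓ′
      B≋ : B ≋ cb₀ ⊕ H̄ℓ ⊛ (cw₀ ⊛ B ⊕ Q ⊛ S′)
      B≋ = S.trans (φ-cong (W-columns b∈K[[tˡ]] isW))
             (S.trans (comp-⊕ _ _ h̄) (S.+-cong (comp-const (b 0) h̄) (φ-tpow-⊛-columnsAtMultiples w)))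
      B≋′ : H̄ℓ ⊛ (Q ⊛ S′) ⊕ cb₀ ⊕ w 0 ·ₛ H̄ℓ ⊛ B ≋ B
      B≋′ = begin
        H̄ℓ ⊛ (Q ⊛ S′) ⊕ cb₀ ⊕ w 0 ·ₛ H̄ℓ ⊛ B
          ≈⟨ ⊕-congˡ (H̄ℓ ⊛ (Q ⊛ S′) ⊕ cb₀) (⊛-congʳ B (·ₛ-≋-const-⊛ (w 0) H̄ℓ)) ⟩
        H̄ℓ ⊛ (Q ⊛ S′) ⊕ cb₀ ⊕ cw₀ ⊛ H̄ℓ ⊛ B
          ≈⟨ solve 5 (λ l qs c₀ w₀ bh → l :* qs :+ c₀ :+ w₀ :* l :* bh := c₀ :+ l :* (w₀ :* bh :+ qs))
                     S.refl H̄ℓ (Q ⊛ S′) cb₀ cw₀ B ⟩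
        cb₀ ⊕ H̄ℓ ⊛ (cw₀ ⊛ B ⊕ Q ⊛ S′)
          ≈⟨ B≋ ⟨
        B ∎
      distribute : (oneS ⊖ w 0 ·ₛ H̄ℓ) ⊛ B ≋ B ⊖ w 0 ·ₛ H̄ℓ ⊛ B
      distribute = S.trans ([y-z]x≈yx-zx B oneS (w 0 ·ₛ H̄ℓ)) (⊕-congʳ (S.- (w 0 ·ₛ H̄ℓ ⊛ B)) (⊛-identityˡ B))
      remainder : H̄ℓ ⊛ (Q ⊛ S′) ≋ (oneS ⊖ w 0 ·ₛ H̄ℓ) ⊛ B ⊖ cb₀
      remainder = S.trans (x≈z//y _ _ _ (x≈z//y _ _ _ B≋′)) (⊕-congʳ (S.- cb₀) (S.sym distribute))

theorem3p1 : ∀ {c r} (K : CommutativeRing c r) → IsField K → PS.CharZero K →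
  let open CommutativeRing K
      open PS K
  in (ℓ : ℕ) → .{{_ : NonZero ℓ}} → 2 ≤ ℓ →
     (b g : Series) (f : ℕ → Series) →
     InPowSeries ℓ b → InPowSeries ℓ g → ¬ (b 0 ≈ 0#) → ¬ (g 0 ≈ 0#) →
     (∀ i → 1 ≤ i → i ≤ ℓ → InTPowSeries ℓ (f i)) →
     (∀ i → 1 ≤ i → i ≤ ℓ → ¬ (f i 1 ≈ 0#)) →
     (h hbar : Series) → h 0 ≈ 0# → pow h ℓ ≋ prodS ℓ f →
     hbar 0 ≈ 0# → comp h hbar ≋ tS → comp hbar h ≋ tS →
     (a : ℕ → Carrier) (z : ℕ → ℕ → Carrier) (w : ℕ → Carrier) →
     IsASequence ℓ b g f a →
     (∀ m → 1 ≤ m → m < ℓ → IsZSequence ℓ b g f m (z m)) →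
     IsZℓSequence ℓ b g f (z ℓ) →
     IsWSequence ℓ b g f w →
     let g₀ = g 0
         b₀ = b 0
         hℓ = pow hbar ℓ
         gh = comp g hbar
     in -- A(t) = t^ℓ / hbar^ℓ
        (hℓ ⊛ spread ℓ a ≋ tpow ℓ)
      × -- Z_1(t) = (1 / hbar^ℓ) (1 - g₀ / g(hbar))
        (hℓ ⊛ gh ⊛ spread ℓ (z 1) ≋ gh ⊖ const g₀)
      × -- Z_m(t) = (1/hbar^ℓ)(1 - g₀ f_{1,1}⋯f_{m-1,1} hbar^{m-1} / (g(hbar) f_1(hbar)⋯f_{m-1}(hbar)))
        (∀ m → 2 ≤ m → m < ℓ →
          let P = gh ⊛ prodS (m ∸ 1) (λ i → comp (f i) hbar)
              c = g₀ * prodC (m ∸ 1) (λ i → f i 1)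
          in hℓ ⊛ P ⊛ spread ℓ (z m) ≋ P ⊖ c ·ₛ pow hbar (m ∸ 1))
      × -- Z_ℓ(t) = C/b₀ + t^ℓ/hbar^ℓ - C b(hbar) f_ℓ(hbar) / (b₀ hbar g(hbar)),
        -- C = g₀ f_{1,1}⋯f_{ℓ-1,1}; multiplied through by b₀ hbar^{ℓ+1} g(hbar)
        (let C = g₀ * prodC (ℓ ∸ 1) (λ i → f i 1)
         in b₀ ·ₛ (hℓ ⊛ hbar ⊛ gh ⊛ spread ℓ (z ℓ))
            ≋ C ·ₛ (hℓ ⊛ hbar ⊛ gh) ⊕ b₀ ·ₛ (tpow ℓ ⊛ hbar ⊛ gh)
              ⊖ C ·ₛ (hℓ ⊛ comp b hbar ⊛ comp (f ℓ) hbar))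
      × -- w₀ = b_ℓ / b₀
        (w 0 * b₀ ≈ b ℓ)
      × -- W(t) = f_ℓ(hbar)((1 - w₀ hbar^ℓ) b(hbar) - b₀) / (hbar^{ℓ+1} g(hbar)) + w₀
        (hℓ ⊛ hbar ⊛ gh ⊛ spread ℓ w
            ≋ comp (f ℓ) hbar ⊛ ((oneS ⊖ w 0 ·ₛ hℓ) ⊛ comp b hbar ⊖ const b₀)
              ⊕ w 0 ·ₛ (hℓ ⊛ hbar ⊛ gh))
theorem3p1 K (_ , inverse) _ ℓ 2≤ℓ b g f b∈K[[tˡ]] g∈K[[tˡ]] _ g₀≢0 f∈tK[[tˡ]] _
           h h̄ h₀≈0 hˡ≋∏f h̄₀≈0 h∘h̄≋t _ _ _ _ isA isZ isZℓ isW =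
  A-generatingFunction isA ,
  Z₁-generatingFunction 2≤ℓ (isZ 1 ℕ.≤-refl 2≤ℓ) ,
  (λ { (suc m) _ 1+m<ℓ → Z-generatingFunction m 1+m<ℓ (isZ (suc m) (s≤s z≤n) 1+m<ℓ) }) ,
  Zℓ-generatingFunction isZℓ ,
  W-head isW ,
  W-generatingFunction b∈K[[tˡ]] isW
  where
  open MultipleAlmostRiordan K
  open Substitution ℓ b g f g∈K[[tˡ]] f∈tK[[tˡ]] h h₀≈0 hˡ≋∏f h̄ h̄₀≈0 h∘h̄≋t (proj₂ (inverse (g 0) g₀≢0))
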